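{- Let $n\ge2$ and let $N$ be a tree-child network on $n$ leaves with $r$ reticulations. Then the number of tree-child respecting SNPR$+$ operations on $N$ is $$4n^2-2nr-8n-2r^2+2r+4-\sum_{e\in E_{PS}}\delta_T(e),$$ and the number of tree-child respecting SNPR$-$ operations on $N$ is $2r$.
   Context: A (rooted binary) phylogenetic network on $n\ge 2$ leaves is a finite directed acyclic graph (parallel edges allowed) with a root of in-degree 0 and out-degree 1, $n$ leaves of in-degree 1 and out-degree 0 bijectively labelled by a fixed taxa set, inner tree vertices of in-degree 1 and out-degree 2, and reticulations of in-degree 2 and out-degree 1. Tree vertices are inner tree vertices, leaves and root. An edge $(u,v)$ is a reticulation edge if $v$ is a reticulation and a tree edge if $v$ is a tree vertex; it is pure if $u,v$ are both tree vertices or both reticulations. A network is tree-child if every non-leaf vertex has a child that is a tree vertex. An edge $(a,b)$ is a descendant of $(c,d)$ if $d=a$ or there is a directed path from $d$ to $a$; $\delta_T(e)$ is the number of descendant edges of $e$ that are tree edges. Two edges are siblings if they share their tail vertex. For $e=(u,v)$ with $u$ not a reticulation and $f$ an edge that is not a descendant of $e$: the SNPR$+$ operation $(e,f)$ subdivides $f$ with a new vertex $u'$ and $e$ with a new vertex $v'$ and adds the edge $(u',v')$ if $f\ne e$, and if $f=e$ it subdivides $e$ twice with new vertices $u'$, $v'$ ($u'$ the parent of $v'$) and adds $(u',v')$. If $e$ is a reticulation edge, the SNPR$-$ operation $(e)$ deletes $e$ and suppresses $u$ and $v$ (a suppressed vertex with parent $p$ and child $c$ is deleted together with its edges and replaced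 by the edge $(p,c)$). An operation is tree-child respecting if its result is a tree-child network; operations are counted as the pairs $(e,f)$, resp. edges $(e)$. $E_{PS}$ is the set of pure tree edges of $N$ that have a sibling edge which is a pure tree edge. -}

module Defs where

open import Data.Nat using (ℕ; zero; suc)
open import Data.Fin using (Fin; _≟_)
open import Data.Bool using (Bool; true; false; T; not; _∧_; _∨_; if_then_else_)
open import Data.Unit using (tt)
open import Data.Empty using (⊥)
open import Data.List using (List; length; map)
open import Data.Nat.ListAction using (sum)
open import Data.List.Membership.Propositional using (_∈_)
open import Data.List.Relation.Unary.Unique.Propositional using (Unique)
open import Data.Product using (Σ; _×_; _,_; proj₁)
open import Data.Sum using (_⊎_)
open import Relation.Nullary using (¬_)
open import Relation.Nullary.Decidable using (⌊_⌋)
open import Relation.Binary.PropositionalEquality using (_≡_; _≢_)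
open import Function.Bundles using (_⇔_)

-- Counting (cardinality of a predicate on a type): there is a
-- duplicate-free list enumerating exactly the elements satisfying P,
-- of length k.  Robust even if P is proof-relevant.

IsCount : {A : Set} → (A → Set) → ℕ → Set
IsCount {A} P k =
  Σ (List A) λ xs → Unique xs × (∀ x → (x ∈ xs) ⇔ P x) × length xs ≡ k

SumOver : {A : Set} → (A → Set) → (A → ℕ) → ℕ → Set
SumOver {A} P g s =
  Σ (List A) λ xs → Unique xs × (∀ x → (x ∈ xs) ⇔ P x) × sum (map g xs) ≡ s

Finite : Set → Set
Finite A = Σ (List A) λ xs → Unique xs × (∀ x → x ∈ xs)

-- Raw directed multigraphs: edges are elements of Edg (so parallel
-- edges are allowed), with tail tl and head hd.

record Graph : Set₁ where
  field
    Vtx Edg : Set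
    tl hd   : Edg → Vtx

module _ (G : Graph) where
  open Graph G

  InDeg OutDeg : Vtx → ℕ → Set
  InDeg  v = IsCount (λ i → hd i ≡ v)
  OutDeg v = IsCount (λ i → tl i ≡ v)

  IsRootV IsLeaf IsInnerTree IsRet : Vtx → Set
  IsRootV     v = InDeg v 0 × OutDeg v 1
  IsLeaf      v = InDeg v 1 × OutDeg v 0
  IsInnerTree v = InDeg v 1 × OutDeg v 2
  IsRet       v = InDeg v 2 × OutDeg v 1

  IsTreeV : Vtx → Set
  IsTreeV v = IsRootV v ⊎ IsLeaf v ⊎ IsInnerTree v

  data Reach : Vtx → Vtx → Set where
    here : ∀ {v} → Reach v v
    step : ∀ {v w} (i : Edg) → tl i ≡ v → Reach (hd i) w → Reach v w

  -- rooted binary phylogenetic network on n leaves (leaf labelling by a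
  -- fixed n-element taxa set is encoded by the number of leaves being n)
  record IsNetwork (n : ℕ) : Set where
    field
      vfinite     : Finite Vtx
      efinite     : Finite Edg
      acyclic     : ∀ (i : Edg) → ¬ Reach (hd i) (tl i)
      root        : Vtx
      root-is     : IsRootV root
      root-unique : ∀ v → IsRootV v → v ≡ root
      kinds       : ∀ v → IsRootV v ⊎ IsLeaf v ⊎ IsInnerTree v ⊎ IsRet v
      leaves      : IsCount IsLeaf n

  IsTreeChild : Set
  IsTreeChild = ∀ v → ¬ IsLeaf v → Σ Edg λ i → tl i ≡ v × IsTreeV (hd i)

  IsDescEdge : Edg → Edg → Set
  IsDescEdge a e = Reach (hd e) (tl a)

  IsTreeEdge IsRetEdge IsPureTreeEdge : Edg → Set
  IsTreeEdge i = IsTreeV (hd i)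
  IsRetEdge  i = IsRet (hd i)
  IsPureTreeEdge i = IsTreeV (tl i) × IsTreeV (hd i)

  DeltaT : Edg → ℕ → Set
  DeltaT e = IsCount (λ a → IsDescEdge a e × IsTreeEdge a)

  InEPS : Edg → Set
  InEPS e = IsPureTreeEdge e × Σ Edg λ f → f ≢ e × tl f ≡ tl e × IsPureTreeEdge f

record FinGraph : Set where
  field
    V E   : ℕ
    tl hd : Fin E → Fin V

toGraph : FinGraph → Graph
toGraph N = record { Vtx = Fin V ; Edg = Fin E ; tl = tl ; hd = hd }
  where open FinGraph N

data NewV (A : Set) : Set where
  oldV      : A → NewV A
  ins-u ins-v : NewV A      -- the new vertices u' and v'

data NewE (A : Set) : Set where
  oldE     : A → NewE A
  x₀ x₁ x₂ : NewE A

-- e = (u,v), f = (x,y).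
-- f ≢ e : edges (u,v'), (v',v), (x,u'), (u',y), (u',v')
-- f ≡ e : edges (u,u'), (u',v'), (v',v), (u',v')
snprPlus : (N : FinGraph) → (e f : Fin (FinGraph.E N)) → Graph
snprPlus N e f = record { Vtx = NewV (Fin V) ; Edg = NewE (Fin E) ; tl = tl' ; hd = hd' }
  where
  open FinGraph N
  tl' hd' : NewE (Fin E) → NewV (Fin V)
  tl' (oldE i) = oldV (tl i)
  tl' x₀ = ins-v
  tl' x₁ = ins-u
  tl' x₂ = ins-u
  hd' (oldE i) = if ⌊ i ≟ f ⌋ then ins-u else (if ⌊ i ≟ e ⌋ then ins-v else oldV (hd i))
  hd' x₀ = oldV (hd e)
  hd' x₁ = if ⌊ e ≟ f ⌋ then ins-v else oldV (hd f)
  hd' x₂ = ins-v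

SNPRPlusRespecting : (n : ℕ) (N : FinGraph) → Fin (FinGraph.E N) × Fin (FinGraph.E N) → Set
SNPRPlusRespecting n N (e , f) =
  ¬ IsRet G (FinGraph.tl N e) × ¬ IsDescEdge G f e
  × IsNetwork (snprPlus N e f) n × IsTreeChild (snprPlus N e f)
  where G = toGraph N

-- SNPR− (e): given also the other child edge cu of u = tl e and the
-- child edge cv of v = hd e.  The edges e, cu, cv and the vertices u, v
-- are removed; the parent edge(s) whose head was u (resp. v) are
-- redirected to the child of u (resp. v), which realises suppression.

T∧ˡ : ∀ a b → T (a ∧ b) → T a
T∧ˡ true  b p = tt
T∧ˡ false b ()

T∧ʳ : ∀ a b → T (a ∧ b) → T b
T∧ʳ true  b p = p
T∧ʳ false b ()

module SNPRMinus (N : FinGraph) (e cu cv : Fin (FinGraph.E N)) where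
  open FinGraph N

  u v : Fin V
  u = tl e
  v = hd e

  keepV : Fin V → Bool
  keepV w = not (⌊ w ≟ u ⌋ ∨ ⌊ w ≟ v ⌋)

  fv fu : Fin V → Fin V
  fv w = if ⌊ w ≟ v ⌋ then hd cv else w
  fu w = if ⌊ w ≟ u ⌋ then fv (hd cu) else fv w

  delE : Fin E → Bool
  delE i = ⌊ i ≟ e ⌋ ∨ ⌊ i ≟ cu ⌋ ∨ ⌊ i ≟ cv ⌋

  keepE : Fin E → Bool
  keepE i = not (delE i) ∧ (keepV (tl i) ∧ keepV (fu (hd i)))

  result : Graph
  result = record
    { Vtx = Σ (Fin V) (λ w → T (keepV w))
    ; Edg = Σ (Fin E) (λ i → T (keepE i))
    ; tl  = λ { (i , p) → tl i , T∧ˡ (keepV (tl i)) (keepV (fu (hd i))) (T∧ʳ (not (delE i)) _ p) }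
    ; hd  = λ { (i , p) → fu (hd i) , T∧ʳ (keepV (tl i)) (keepV (fu (hd i))) (T∧ʳ (not (delE i)) _ p) }
    }

SNPRMinusRespecting : (n : ℕ) (N : FinGraph) → Fin (FinGraph.E N) → Set
SNPRMinusRespecting n N e =
  IsRetEdge G e × IsInnerTree G (tl e) ×
  Σ (Fin E) λ cu → Σ (Fin E) λ cv →
    tl cu ≡ tl e × cu ≢ e × tl cv ≡ hd e ×
    IsNetwork (SNPRMinus.result N e cu cv) n × IsTreeChild (SNPRMinus.result N e cu cv)
  where
  open FinGraph N
  G = toGraph N

-- An SNPR⁺ operation (e, f) leaves a tree-child network exactly when e ∈ E_PS, f is a tree edge other than e
-- and f is not a descendant of e: otherwise a new vertex or the tail of e loses its last tree child, or a cycle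
-- appears. So these operations number Σ_{e ∈ E_PS} (T - 1 - δ_T(e)), where T = n + t counts the tree edges and
-- t the inner tree vertices. An inner tree vertex either has two tree children (m of them, whose out-edges form
-- E_PS, so |E_PS| = 2m) or is the tail of exactly one reticulation edge (2r of them), and counting edges by head
-- and by tail gives n = 1 + m + r; substituting yields the closed formula. Deleting a reticulation edge and
-- suppressing its ends keeps the degrees of all other vertices, acyclicity and tree-childness, so every one of
-- the 2r reticulation edges gives a respecting SNPR⁻ operation.
module Submission where

open import Defs
open import Data.Bool using (Bool; T)
open import Data.Bool.Properties using (T-irrelevant; T?)
open import Data.Empty using (⊥; ⊥-elim)
open import Data.Fin using (Fin; _≟_)
open import Data.Integer using (ℤ; +_) renaming (_+_ to _+ℤ_; _-_ to _-ℤ_; _*_ to _*ℤ_)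
import Data.Integer.Properties as ℤ
import Data.Integer.Tactic.RingSolver as ℤ-Solver
open import Data.List using (List; []; _∷_; length; map; _++_; filter; allFin)
open import Data.List.Properties using (length-++; filter-notAll)
open import Data.List.Membership.Propositional using (_∈_; _∉_)
open import Data.List.Membership.Propositional.Properties
  using (∈-++⁺ˡ; ∈-++⁺ʳ; ∈-++⁻; ∈-filter⁺; ∈-filter⁻; ∈-map⁺; ∈-map⁻; ∈-allFin)
open import Data.List.Membership.Propositional.Properties.WithK using (unique∧set⇒bag)
import Data.List.Membership.DecPropositional as DecMembership
open import Data.List.Relation.Unary.All as All using (All; []; _∷_)
open import Data.List.Relation.Unary.AllPairs using ([]; _∷_)
open import Data.List.Relation.Unary.Any as Any using (Any; here; there; any?)
open import Data.List.Relation.Unary.Unique.Propositional using (Unique)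
import Data.List.Relation.Unary.Unique.Propositional.Properties as Unique
open import Data.List.Relation.Binary.BagAndSetEquality using (∼bag⇒↭)
open import Data.List.Relation.Binary.Permutation.Propositional using (_↭_)
import Data.List.Relation.Binary.Permutation.Propositional.Properties as ↭
open import Data.Nat using (ℕ; suc; _+_; _*_; _≤_; _<_; s≤s)
import Data.Nat as ℕ
open import Data.Nat.Properties using (+-commutativeSemigroup; +-cancelʳ-≡; *-comm; n<1+n; <-≤-trans)
import Data.Nat.Tactic.RingSolver as ℕ-Solver
open import Data.Nat.ListAction using (sum)
open import Data.Nat.ListAction.Properties using (sum-↭)
open import Data.Product using (Σ; _×_; _,_; proj₁; proj₂; uncurry)
import Data.Product as Product
open import Data.Sum using (_⊎_; inj₁; inj₂; [_,_]; [_,_]′)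
import Data.Sum as Sum
open import Data.Unit using (⊤; tt)
open import Function using (_∘_; id; case_of_)
open import Function.Bundles using (_⇔_; mk⇔; Equivalence)
open import Relation.Nullary using (¬_; Dec; yes; no; ¬?)
open import Relation.Nullary.Decidable using (map′; _×-dec_; _⊎-dec_)
open import Relation.Unary using (Decidable)
open import Relation.Binary.Definitions using (DecidableEquality)
open import Relation.Binary.PropositionalEquality
  using (_≡_; _≢_; refl; sym; trans; cong; cong₂; subst; subst₂; module ≡-Reasoning)
open import Algebra.Properties.CommutativeSemigroup +-commutativeSemigroup
  using () renaming (interchange to +-interchange; x∙yz≈y∙xz to +-left-comm)

open Equivalence using (to; from)

module _ {A : Set} {P : A → Set} where

  enumerations-↭ : ∀ {xs ys : List A} → Unique xs → Unique ys →
    (∀ x → x ∈ xs ⇔ P x) → (∀ x → x ∈ ys ⇔ P x) → xs ↭ ys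
  enumerations-↭ u v mx my = ∼bag⇒↭ (unique∧set⇒bag u v
    (λ {x} → mk⇔ (from (my x) ∘ to (mx x)) (from (mx x) ∘ to (my x))))

  IsCount-unique : ∀ {k m} → IsCount P k → IsCount P m → k ≡ m
  IsCount-unique (xs , u , mx , refl) (ys , v , my , refl) = ↭.↭-length (enumerations-↭ u v mx my)

  SumOver-unique : ∀ {g : A → ℕ} {s t} → SumOver P g s → SumOver P g t → s ≡ t
  SumOver-unique {g} (xs , u , mx , refl) (ys , v , my , refl) =
    sum-↭ (↭.map⁺ g (enumerations-↭ u v mx my))

  IsCount-zero : (∀ x → ¬ P x) → IsCount P 0
  IsCount-zero ¬P = [] , [] , (λ x → mk⇔ (λ ()) (⊥-elim ∘ ¬P x)) , refl

  IsCount-one : ∀ a → P a → (∀ x → P x → x ≡ a) → IsCount P 1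
  IsCount-one a pa only = a ∷ [] , [] ∷ [] ,
    (λ x → mk⇔ (λ { (here refl) → pa }) (here ∘ only x)) , refl

  IsCount-two : ∀ a b → P a → P b → a ≢ b → (∀ x → P x → x ≡ a ⊎ x ≡ b) → IsCount P 2
  IsCount-two a b pa pb a≢b only = a ∷ b ∷ [] , (a≢b ∷ []) ∷ [] ∷ [] ,
    (λ x → mk⇔ (λ { (here refl) → pa ; (there (here refl)) → pb })
               ([ (λ p → here p) , (λ p → there (here p)) ] ∘ only x)) , refl

  IsCount-zero⇒¬ : ∀ {a} → IsCount P 0 → ¬ P a
  IsCount-zero⇒¬ ([] , _ , m , _) pa with () ← from (m _) pa

  IsCount-one⇒≡ : ∀ {a b} → IsCount P 1 → P a → P b → a ≡ b
  IsCount-one⇒≡ (x ∷ [] , _ , m , _) pa pb with here refl ← from (m _) pa | here refl ← from (m _) pb = refl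

  IsCount-one⇒∃ : IsCount P 1 → Σ A P
  IsCount-one⇒∃ (x ∷ [] , _ , m , _) = x , to (m x) (here refl)

  IsCount-two⇒∃ : IsCount P 2 → Σ A λ a → Σ A λ b → P a × P b × a ≢ b
  IsCount-two⇒∃ (x ∷ y ∷ [] , (x≢y ∷ []) ∷ _ , m , _) =
    x , y , to (m x) (here refl) , to (m y) (there (here refl)) , x≢y

  IsCount-two⇒≡⊎≡ : ∀ {a b c} → IsCount P 2 → P a → P b → a ≢ b → P c → c ≡ a ⊎ c ≡ b
  IsCount-two⇒≡⊎≡ (x ∷ y ∷ [] , _ , m , _) pa pb a≢b pc
    with from (m _) pa | from (m _) pb | from (m _) pc
  ... | here refl         | here refl         | _                 = ⊥-elim (a≢b refl)
  ... | there (here refl) | there (here refl) | _                 = ⊥-elim (a≢b refl)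
  ... | here refl         | there (here refl) | here refl         = inj₁ refl
  ... | here refl         | there (here refl) | there (here refl) = inj₂ refl
  ... | there (here refl) | here refl         | here refl         = inj₂ refl
  ... | there (here refl) | here refl         | there (here refl) = inj₁ refl

  IsCount-finite : Finite A → Decidable P → Σ ℕ (IsCount P)
  IsCount-finite (xs , u , all) P? = length (filter P? xs) , filter P? xs , Unique.filter⁺ P? {xs} u ,
    (λ x → mk⇔ (proj₂ ∘ ∈-filter⁻ P? {xs = xs}) (∈-filter⁺ P? (all x))) , refl

module _ {A : Set} {P Q : A → Set} where

  IsCount-cong : ∀ {k} → (∀ x → P x → Q x) → (∀ x → Q x → P x) → IsCount P k → IsCount Q k
  IsCount-cong P⇒Q Q⇒P (xs , u , m , l) =
    xs , u , (λ x → mk⇔ (P⇒Q x ∘ to (m x)) (from (m x) ∘ Q⇒P x)) , l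

  IsCount-⊎ : ∀ {k l} → IsCount P k → IsCount Q l → (∀ x → P x → ¬ Q x) →
    IsCount (λ x → P x ⊎ Q x) (k + l)
  IsCount-⊎ (xs , u , mx , refl) (ys , v , my , refl) disjoint =
    xs ++ ys , Unique.++⁺ u v (λ (x∈xs , x∈ys) → disjoint _ (to (mx _) x∈xs) (to (my _) x∈ys)) ,
    (λ x → mk⇔ ([ inj₁ ∘ to (mx x) , inj₂ ∘ to (my x) ] ∘ ∈-++⁻ xs)
               [ ∈-++⁺ˡ ∘ from (mx x) , ∈-++⁺ʳ xs ∘ from (my x) ]) ,
    length-++ xs

module _ {A B : Set} {P : A → Set} {Q : B → Set} (h : ∀ a → P a → B) where

  private
    mapWith : (xs : List A) → All P xs → List B
    mapWith []       []       = []
    mapWith (x ∷ xs) (p ∷ ps) = h x p ∷ mapWith xs ps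

    length-mapWith : ∀ xs ps → length (mapWith xs ps) ≡ length xs
    length-mapWith []       []       = refl
    length-mapWith (x ∷ xs) (p ∷ ps) = cong suc (length-mapWith xs ps)

    ∈-mapWith⁻ : ∀ xs ps {b} → b ∈ mapWith xs ps → Σ A λ a → Σ (P a) λ p → a ∈ xs × h a p ≡ b
    ∈-mapWith⁻ (x ∷ xs) (p ∷ ps) (here refl) = x , p , here refl , refl
    ∈-mapWith⁻ (x ∷ xs) (p ∷ ps) (there b∈) with a , q , a∈ , eq ← ∈-mapWith⁻ xs ps b∈ =
      a , q , there a∈ , eq

    ∈-mapWith⁺ : ∀ xs ps {a} → a ∈ xs → Σ (P a) λ p → h a p ∈ mapWith xs ps
    ∈-mapWith⁺ (x ∷ xs) (p ∷ ps) (here refl) = p , here refl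
    ∈-mapWith⁺ (x ∷ xs) (p ∷ ps) (there a∈) with q , b∈ ← ∈-mapWith⁺ xs ps a∈ = q , there b∈

  IsCount-image : ∀ {k} → IsCount P k →
    (∀ {a a'} p p' → h a p ≡ h a' p' → a ≡ a') →
    (∀ a p → Q (h a p)) →
    (∀ b → Q b → Σ A λ a → P a × (∀ p → h a p ≡ b)) →
    IsCount Q k
  IsCount-image (xs , u , m , refl) injective into onto =
    mapWith xs ps , unique xs ps u ,
    (λ b → mk⇔ (into′ b) (onto′ b)) , length-mapWith xs ps
    where
    ps : All P xs
    ps = All.tabulate (to (m _))

    unique : ∀ xs ps → Unique xs → Unique (mapWith xs ps)
    unique []       []       []       = []
    unique (x ∷ xs) (p ∷ ps) (x∉ ∷ u) = All.tabulate fresh ∷ unique xs ps u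
      where
      fresh : ∀ {b} → b ∈ mapWith xs ps → h x p ≢ b
      fresh b∈ eq with a , q , a∈ , refl ← ∈-mapWith⁻ xs ps b∈ = All.lookup x∉ a∈ (injective p q eq)

    into′ : ∀ b → b ∈ mapWith xs ps → Q b
    into′ b b∈ with a , p , _ , refl ← ∈-mapWith⁻ xs ps b∈ = into a p

    onto′ : ∀ b → Q b → b ∈ mapWith xs ps
    onto′ b qb with a , pa , ha≡b ← onto b qb with p , b∈ ← ∈-mapWith⁺ xs ps (from (m a) pa) =
      subst (_∈ mapWith xs ps) (ha≡b p) b∈

module _ {A B : Set} (h : A → B) where

  IsCount-preimage : ∀ {Q : B → Set} {c} d → IsCount Q c →
    (∀ b → Q b → IsCount (λ a → h a ≡ b) d) → IsCount (λ a → Q (h a)) (c * d)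
  IsCount-preimage {Q} d (xs , u , m , refl) fibre =
    IsCount-cong (λ a → to (m (h a))) (λ a → from (m (h a))) (preimage xs u (λ b → fibre b ∘ to (m b)))
    where
    preimage : ∀ xs → Unique xs → (∀ b → b ∈ xs → IsCount (λ a → h a ≡ b) d) →
      IsCount (λ a → h a ∈ xs) (length xs * d)
    preimage []       []       _     = IsCount-zero (λ _ ())
    preimage (x ∷ xs) (x∉ ∷ u) fibre =
      IsCount-cong (λ a → [ here , there ]) (λ a → λ { (here eq) → inj₁ eq ; (there a∈) → inj₂ a∈ })
        (IsCount-⊎ (fibre x (here refl)) (preimage xs u (λ b → fibre b ∘ there))
          (λ a → λ { refl a∈ → All.lookup x∉ a∈ refl }))

module _ {A B : Set} {P : A → Set} (F : A → B → Set) {c : A → ℕ} where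

  IsCount-Σ : ∀ {k} → SumOver P c k → (∀ a → P a → IsCount (F a) (c a)) →
    IsCount (λ (ab : A × B) → P (proj₁ ab) × F (proj₁ ab) (proj₂ ab)) k
  IsCount-Σ (xs , u , m , refl) fibre =
    IsCount-cong (λ _ (a∈ , q) → to (m _) a∈ , q) (λ _ (pa , q) → from (m _) pa , q)
      (pairs xs u (λ a → fibre a ∘ to (m a)))
    where
    pairs : ∀ xs → Unique xs → (∀ a → a ∈ xs → IsCount (F a) (c a)) →
      IsCount (λ (ab : A × B) → proj₁ ab ∈ xs × F (proj₁ ab) (proj₂ ab)) (sum (map c xs))
    pairs []       []       _     = IsCount-zero (λ _ ())
    pairs (x ∷ xs) (x∉ ∷ u) fibre =
      IsCount-cong (λ _ → [ (λ { (refl , q) → here refl , q }) , (λ (a∈ , q) → there a∈ , q) ])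
                   (λ _ → λ { (here refl , q) → inj₁ (refl , q) ; (there a∈ , q) → inj₂ (a∈ , q) })
        (IsCount-⊎ row (pairs xs u (λ a → fibre a ∘ there))
          (λ _ → λ { (refl , _) (a∈ , _) → All.lookup x∉ a∈ refl }))
      where
      row : IsCount (λ (ab : A × B) → proj₁ ab ≡ x × F (proj₁ ab) (proj₂ ab)) (c x)
      row = IsCount-image (λ b _ → x , b) (fibre x (here refl)) (λ { _ _ refl → refl })
        (λ _ q → refl , q) (λ { (_ , b) (refl , q) → b , q , (λ _ → refl) })

module _ {A : Set} {P : A → Set} where

  SumOver-exists : ∀ {m} → IsCount P m → (g : A → ℕ) → Σ ℕ (SumOver P g)
  SumOver-exists (xs , u , mx , _) g = sum (map g xs) , xs , u , mx , refl

  SumOver-suc : ∀ {g : A → ℕ} {m s} → IsCount P m → SumOver P g s → SumOver P (suc ∘ g) (m + s)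
  SumOver-suc {g} Pm (xs , u , mx , refl) rewrite IsCount-unique Pm (xs , u , mx , refl) = xs , u , mx , sum-suc xs
    where
    sum-suc : ∀ xs → sum (map (suc ∘ g) xs) ≡ length xs + sum (map g xs)
    sum-suc []       = refl
    sum-suc (x ∷ xs) = cong suc (trans (cong (_+_ (g x)) (sum-suc xs)) (+-left-comm (g x) (length xs) _))

module _ {A : Set} {P : A → Set} {f g : A → ℕ} (T : ℕ) (f+g≡T : ∀ a → P a → f a + g a ≡ T) where

  SumOver-complementary : ∀ {s t m} → SumOver P f s → SumOver P g t → IsCount P m → s + t ≡ m * T
  SumOver-complementary (xs , u , mx , refl) Σg Pm
    rewrite SumOver-unique Σg (xs , u , mx , refl)
          | IsCount-unique Pm (xs , u , mx , refl) = sums xs (All.tabulate (λ {a} → f+g≡T a ∘ to (mx a)))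
    where
    sums : ∀ xs → All (λ a → f a + g a ≡ T) xs → sum (map f xs) + sum (map g xs) ≡ length xs * T
    sums []       []         = refl
    sums (x ∷ xs) (eq ∷ eqs) = begin
      (f x + sum (map f xs)) + (g x + sum (map g xs)) ≡⟨ +-interchange (f x) _ (g x) _ ⟩
      (f x + g x) + (sum (map f xs) + sum (map g xs)) ≡⟨ cong₂ _+_ eq (sums xs eqs) ⟩
      T + length xs * T                               ∎
      where open ≡-Reasoning

module _ {A B : Set} {embed : A → B} (embed-injective : ∀ {a a'} → embed a ≡ embed a' → a ≡ a') where

  Finite-extend : (new : List B) → Unique new → (∀ a → embed a ∉ new) →
    (∀ b → (Σ A λ a → embed a ≡ b) ⊎ b ∈ new) → Finite A → Finite B
  Finite-extend new unique-new old∉new cover (xs , u , all) =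
    map embed xs ++ new ,
    Unique.++⁺ (Unique.map⁺ embed-injective u) unique-new
      (λ (b∈old , b∈new) → case ∈-map⁻ embed b∈old of λ { (a , _ , refl) → old∉new a b∈new }) ,
    λ b → [ (λ { (a , refl) → ∈-++⁺ˡ (∈-map⁺ embed (all a)) }) , ∈-++⁺ʳ _ ] (cover b)

Finite-Σ : ∀ {A : Set} {P : A → Set} → (∀ {a} (p q : P a) → p ≡ q) → Decidable P → Finite A → Finite (Σ A P)
Finite-Σ {P = P} irrelevant P? finite
  with _ , (ys , u , m , _) ← IsCount-finite finite P?
  with xs , v , mx , _ ← IsCount-image {Q = λ _ → ⊤} (λ a p → a , p) (ys , u , m , refl)
                           (λ { _ _ refl → refl }) (λ _ _ → tt)
                           (λ (a , p) _ → a , p , λ q → cong (a ,_) (irrelevant q p))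
  = xs , v , λ x → from (mx x) tt

Finite-Fin : ∀ {k} → Finite (Fin k)
Finite-Fin = allFin _ , Unique.allFin⁺ _ , ∈-allFin

module _ {G : Graph} where
  open Graph G

  Reach-trans : ∀ {a b c} → Reach G a b → Reach G b c → Reach G a c
  Reach-trans here         q = q
  Reach-trans (step i e p) q = step i e (Reach-trans p q)

  Reach-edge : ∀ i → Reach G (tl i) (hd i)
  Reach-edge i = step i refl here

  Reach-last : ∀ {a b} → Reach G a b → a ≡ b ⊎ Σ Edg λ i → Reach G a (tl i) × hd i ≡ b
  Reach-last here = inj₁ refl
  Reach-last (step i refl p) with Reach-last p
  ... | inj₁ refl           = inj₂ (i , here , refl)
  ... | inj₂ (j , q , hd≡b) = inj₂ (j , step i refl q , hd≡b)

  root-¬leaf : ∀ {v} → IsRootV G v → ¬ IsLeaf G v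
  root-¬leaf (in₀ , _) (in₁ , _) with () ← IsCount-unique in₀ in₁

  root-¬inner : ∀ {v} → IsRootV G v → ¬ IsInnerTree G v
  root-¬inner (in₀ , _) (in₁ , _) with () ← IsCount-unique in₀ in₁

  root-¬ret : ∀ {v} → IsRootV G v → ¬ IsRet G v
  root-¬ret (in₀ , _) (in₂ , _) with () ← IsCount-unique in₀ in₂

  leaf-¬inner : ∀ {v} → IsLeaf G v → ¬ IsInnerTree G v
  leaf-¬inner (_ , out₀) (_ , out₂) with () ← IsCount-unique out₀ out₂

  leaf-¬ret : ∀ {v} → IsLeaf G v → ¬ IsRet G v
  leaf-¬ret (in₁ , _) (in₂ , _) with () ← IsCount-unique in₁ in₂

  inner-¬ret : ∀ {v} → IsInnerTree G v → ¬ IsRet G v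
  inner-¬ret (in₁ , _) (in₂ , _) with () ← IsCount-unique in₁ in₂

  tree-¬ret : ∀ {v} → IsTreeV G v → ¬ IsRet G v
  tree-¬ret (inj₁ root)         = root-¬ret root
  tree-¬ret (inj₂ (inj₁ leaf))  = leaf-¬ret leaf
  tree-¬ret (inj₂ (inj₂ inner)) = inner-¬ret inner

  leaf-¬tail : ∀ {v} i → tl i ≡ v → ¬ IsLeaf G v
  leaf-¬tail i tl≡v (_ , out₀) = IsCount-zero⇒¬ out₀ tl≡v

  tree-in-unique : ∀ {v i j} → IsTreeV G v → hd i ≡ v → hd j ≡ v → i ≡ j
  tree-in-unique (inj₁ (in₀ , _))        hd≡v _    = ⊥-elim (IsCount-zero⇒¬ in₀ hd≡v)
  tree-in-unique (inj₂ (inj₁ (in₁ , _))) hi   hj   = IsCount-one⇒≡ in₁ hi hj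
  tree-in-unique (inj₂ (inj₂ (in₁ , _))) hi   hj   = IsCount-one⇒≡ in₁ hi hj

  two-out⇒inner : ∀ {v i j} → IsRootV G v ⊎ IsLeaf G v ⊎ IsInnerTree G v ⊎ IsRet G v →
    tl i ≡ v → tl j ≡ v → i ≢ j → IsInnerTree G v
  two-out⇒inner (inj₁ (_ , out₁))               ti tj i≢j = ⊥-elim (i≢j (IsCount-one⇒≡ out₁ ti tj))
  two-out⇒inner (inj₂ (inj₁ (_ , out₀)))        ti _  _   = ⊥-elim (IsCount-zero⇒¬ out₀ ti)
  two-out⇒inner (inj₂ (inj₂ (inj₁ inner)))      _  _  _   = inner
  two-out⇒inner (inj₂ (inj₂ (inj₂ (_ , out₁)))) ti tj i≢j = ⊥-elim (i≢j (IsCount-one⇒≡ out₁ ti tj))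

  module _ (edges : Finite Edg) (_≟V_ : DecidableEquality Vtx) where

    in-degree : ∀ v → Σ ℕ (InDeg G v)
    in-degree v = IsCount-finite edges (λ i → hd i ≟V v)

    out-degree : ∀ v → Σ ℕ (OutDeg G v)
    out-degree v = IsCount-finite edges (λ i → tl i ≟V v)

    degrees? : ∀ v a b → Dec (InDeg G v a × OutDeg G v b)
    degrees? v a b with in-degree v | out-degree v
    ... | k , in-k | l , out-l =
      map′ (λ { (refl , refl) → in-k , out-l })
           (λ (in-a , out-b) → IsCount-unique in-k in-a , IsCount-unique out-l out-b)
           ((k ℕ.≟ a) ×-dec (l ℕ.≟ b))

    IsInnerTree? : ∀ v → Dec (IsInnerTree G v)
    IsInnerTree? v = degrees? v 1 2

    IsTreeV? : ∀ v → Dec (IsTreeV G v)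
    IsTreeV? v = degrees? v 0 1 ⊎-dec degrees? v 1 0 ⊎-dec degrees? v 1 2

SameDegrees : (G : Graph) → Graph.Vtx G → (G' : Graph) → Graph.Vtx G' → Set
SameDegrees G w G' w' = (∀ k → InDeg G w k ⇔ InDeg G' w' k) × (∀ k → OutDeg G w k ⇔ OutDeg G' w' k)

module _ {G G' : Graph} {w : Graph.Vtx G} {w' : Graph.Vtx G'} where

  sameDegrees : Σ ℕ (InDeg G w) → Σ ℕ (OutDeg G w) →
    (∀ k → InDeg G w k → InDeg G' w' k) → (∀ k → OutDeg G w k → OutDeg G' w' k) →
    SameDegrees G w G' w'
  sameDegrees (k₀ , in-k₀) (l₀ , out-l₀) in→ out→ =
    (λ k → mk⇔ (in→ k) (λ in-k → subst (InDeg G w) (IsCount-unique (in→ k₀ in-k₀) in-k) in-k₀)) ,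
    (λ l → mk⇔ (out→ l) (λ out-l → subst (OutDeg G w) (IsCount-unique (out→ l₀ out-l₀) out-l) out-l₀))

  SameDegrees-sym : SameDegrees G w G' w' → SameDegrees G' w' G w
  SameDegrees-sym (in⇔ , out⇔) = (λ k → mk⇔ (from (in⇔ k)) (to (in⇔ k))) , (λ k → mk⇔ (from (out⇔ k)) (to (out⇔ k)))

  degrees-transfer : SameDegrees G w G' w' → ∀ {a b} → InDeg G w a × OutDeg G w b → InDeg G' w' a × OutDeg G' w' b
  degrees-transfer (in⇔ , out⇔) (in-a , out-b) = to (in⇔ _) in-a , to (out⇔ _) out-b

  IsTreeV-transfer : SameDegrees G w G' w' → IsTreeV G w → IsTreeV G' w'
  IsTreeV-transfer same (inj₁ root)         = inj₁ (degrees-transfer same root)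
  IsTreeV-transfer same (inj₂ (inj₁ leaf))  = inj₂ (inj₁ (degrees-transfer same leaf))
  IsTreeV-transfer same (inj₂ (inj₂ inner)) = inj₂ (inj₂ (degrees-transfer same inner))

  kind-transfer : SameDegrees G w G' w' → IsRootV G w ⊎ IsLeaf G w ⊎ IsInnerTree G w ⊎ IsRet G w →
    IsRootV G' w' ⊎ IsLeaf G' w' ⊎ IsInnerTree G' w' ⊎ IsRet G' w'
  kind-transfer same (inj₁ root)                = inj₁ (degrees-transfer same root)
  kind-transfer same (inj₂ (inj₁ leaf))         = inj₂ (inj₁ (degrees-transfer same leaf))
  kind-transfer same (inj₂ (inj₂ (inj₁ inner))) = inj₂ (inj₂ (inj₁ (degrees-transfer same inner)))
  kind-transfer same (inj₂ (inj₂ (inj₂ ret)))   = inj₂ (inj₂ (inj₂ (degrees-transfer same ret)))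

module Reachability (G : Graph) (_≟V_ : DecidableEquality (Graph.Vtx G))
  (vertices : Finite (Graph.Vtx G)) (edges : Finite (Graph.Edg G))
  (acyclic : ∀ i → ¬ Reach G (Graph.hd G i) (Graph.tl G i)) where
  open Graph G
  open DecMembership _≟V_ using (_∈?_)

  private
    _∈after_ : ∀ {a b} → Vtx → Reach G a b → Set
    w ∈after here       = ⊥
    w ∈after step i _ p = hd i ≡ w ⊎ w ∈after p

    ∈after⇒Reach : ∀ {a b w} (p : Reach G a b) → w ∈after p → Σ Edg λ j → Reach G a (tl j) × hd j ≡ w
    ∈after⇒Reach (step i refl p) (inj₁ hd≡w) = i , here , hd≡w
    ∈after⇒Reach (step i refl p) (inj₂ w∈) with j , q , hd≡w ← ∈after⇒Reach p w∈ = j , step i refl q , hd≡w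

    start-∉after : ∀ {a b} (p : Reach G a b) → ¬ a ∈after p
    start-∉after p a∈ with j , q , refl ← ∈after⇒Reach p a∈ = acyclic j q

    ReachWithin : List Vtx → Vtx → Vtx → Set
    ReachWithin av a b = Σ (Reach G a b) λ p → ∀ w → w ∈after p → w ∈ av

    -- Only paths whose vertices after the start lie in av are searched, and each step removes the vertex
    -- it enters from av; by acyclicity no path revisits a vertex, so nothing is lost and the search terminates.
    _-_ : List Vtx → Vtx → List Vtx
    av - x = filter (λ w → ¬? (w ≟V x)) av

    shorter : ∀ av {x} → x ∈ av → length (av - x) < length av
    shorter av x∈ = filter-notAll _ av (Any.map (λ { refl x≢x → x≢x refl }) x∈)

    Step : List Vtx → Vtx → Vtx → Edg → Set
    Step av a b i = tl i ≡ a × hd i ∈ av × ReachWithin (av - hd i) (hd i) b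

    reachWithin? : ∀ n av a b → length av < n → Dec (ReachWithin av a b)
    reachWithin? (suc n) av a b (s≤s l) with a ≟V b
    ... | yes refl = yes (here , λ _ ())
    ... | no a≢b = map′ fromStep toStep (any? step? (proj₁ edges))
      where
      step? : ∀ i → Dec (Step av a b i)
      step? i with tl i ≟V a | hd i ∈? av
      ... | no tl≢a | _      = no (tl≢a ∘ proj₁)
      ... | yes _   | no hd∉ = no (hd∉ ∘ proj₁ ∘ proj₂)
      ... | yes tl≡a | yes hd∈ = map′ (λ w → tl≡a , hd∈ , w) (proj₂ ∘ proj₂)
        (reachWithin? n (av - hd i) (hd i) b (<-≤-trans (shorter av hd∈) l))

      fromStep : Any (Step av a b) (proj₁ edges) → ReachWithin av a b
      fromStep any with i , refl , hd∈ , p , within ← Any.satisfied any =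
        step i refl p , λ { w (inj₁ refl) → hd∈ ; w (inj₂ w∈) → proj₁ (∈-filter⁻ _ (within w w∈)) }

      toStep : ReachWithin av a b → Any (Step av a b) (proj₁ edges)
      toStep (here , _) = ⊥-elim (a≢b refl)
      toStep (step i refl p , within) = Any.map (λ { refl → refl , within (hd i) (inj₁ refl) , p , within′ })
        (proj₂ (proj₂ edges) i)
        where
        within′ : ∀ w → w ∈after p → w ∈ av - hd i
        within′ w w∈ = ∈-filter⁺ _ (within w (inj₂ w∈)) (λ { refl → start-∉after p w∈ })

  Reach? : ∀ a b → Dec (Reach G a b)
  Reach? a b = map′ proj₁ (λ p → p , λ w _ → proj₂ (proj₂ vertices) w)
    (reachWithin? _ (proj₁ vertices) a b (n<1+n _))

module TreeChildNetwork {G : Graph} (_≟V_ : DecidableEquality (Graph.Vtx G))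
  (_≟E_ : DecidableEquality (Graph.Edg G)) {n} (net : IsNetwork G n) (tc : IsTreeChild G) where
  open Graph G
  open IsNetwork net

  non-tree⇒ret : ∀ v → ¬ IsTreeV G v → IsRet G v
  non-tree⇒ret v ¬tree with kinds v
  ... | inj₁ root                = ⊥-elim (¬tree (inj₁ root))
  ... | inj₂ (inj₁ leaf)         = ⊥-elim (¬tree (inj₂ (inj₁ leaf)))
  ... | inj₂ (inj₂ (inj₁ inner)) = ⊥-elim (¬tree (inj₂ (inj₂ inner)))
  ... | inj₂ (inj₂ (inj₂ ret))   = ret

  ¬ret⇒tree : ∀ v → ¬ IsRet G v → IsTreeV G v
  ¬ret⇒tree v ¬ret with kinds v
  ... | inj₁ root                = inj₁ root
  ... | inj₂ (inj₁ leaf)         = inj₂ (inj₁ leaf)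
  ... | inj₂ (inj₂ (inj₁ inner)) = inj₂ (inj₂ inner)
  ... | inj₂ (inj₂ (inj₂ ret))   = ⊥-elim (¬ret ret)

  -- By tree-childness the other out-edge of the tail leads to a tree vertex, so the tail has out-degree 2.
  ret-parent-inner : ∀ a → IsRet G (hd a) → IsInnerTree G (tl a)
  ret-parent-inner a ret with tc (tl a) (leaf-¬tail a refl)
  ... | j , tl≡ , tree = two-out⇒inner (kinds (tl a)) refl tl≡ (λ { refl → tree-¬ret tree ret })

  ret-child-unique : ∀ a a' → IsRet G (hd a) → IsRet G (hd a') → tl a ≡ tl a' → a ≡ a'
  ret-child-unique a a' ret ret' tl≡ with a ≟E a'
  ... | yes a≡a' = a≡a'
  ... | no a≢a' with j , tl-j , tree ← tc (tl a) (leaf-¬tail a refl)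
    with IsCount-two⇒≡⊎≡ (proj₂ (ret-parent-inner a ret)) refl (sym tl≡) a≢a' tl-j
  ... | inj₁ refl = ⊥-elim (tree-¬ret tree ret)
  ... | inj₂ refl = ⊥-elim (tree-¬ret tree ret')

  children : ∀ {v} → IsInnerTree G v → Σ Edg λ a → Σ Edg λ b → tl a ≡ v × tl b ≡ v × a ≢ b
  children inner = IsCount-two⇒∃ (proj₂ inner)

  IsTreeFork IsRetParent : Vtx → Set
  IsTreeFork v = IsInnerTree G v × (∀ j → tl j ≡ v → IsTreeV G (hd j))
  IsRetParent v = IsInnerTree G v × Σ Edg λ j → tl j ≡ v × IsRet G (hd j)

  inner-cases : ∀ v → IsInnerTree G v → IsTreeFork v ⊎ IsRetParent v
  inner-cases v inner with a , b , tl-a , tl-b , a≢b ← children inner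
    with IsTreeV? efinite _≟V_ (hd a) | IsTreeV? efinite _≟V_ (hd b)
  ... | no ¬tree | _        = inj₂ (inner , a , tl-a , non-tree⇒ret _ ¬tree)
  ... | yes _    | no ¬tree = inj₂ (inner , b , tl-b , non-tree⇒ret _ ¬tree)
  ... | yes ta   | yes tb   = inj₁ (inner , λ j tl-j →
    [ (λ { refl → ta }) , (λ { refl → tb }) ] (IsCount-two⇒≡⊎≡ (proj₂ inner) tl-a tl-b a≢b tl-j))

  EPS⇒tree-fork : ∀ i → InEPS G i → IsTreeFork (tl i)
  EPS⇒tree-fork i ((_ , tree-i) , f , f≢i , tl≡ , (_ , tree-f)) = inner , λ j tl-j →
    [ (λ { refl → tree-i }) , (λ { refl → tree-f }) ] (IsCount-two⇒≡⊎≡ (proj₂ inner) refl tl≡ (f≢i ∘ sym) tl-j)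
    where
    inner : IsInnerTree G (tl i)
    inner = two-out⇒inner (kinds (tl i)) refl tl≡ (f≢i ∘ sym)

  tree-fork-edge-pure : ∀ {v j} → IsTreeFork v → tl j ≡ v → IsPureTreeEdge G j
  tree-fork-edge-pure (inner , tree-child) tl-j = subst (IsTreeV G) (sym tl-j) (inj₂ (inj₂ inner)) , tree-child _ tl-j

  tree-fork⇒EPS : ∀ i → IsTreeFork (tl i) → InEPS G i
  tree-fork⇒EPS i fork with a , b , tl-a , tl-b , a≢b ← children (proj₁ fork) | a ≟E i
  ... | yes refl = tree-fork-edge-pure fork refl , b , a≢b ∘ sym , tl-b , tree-fork-edge-pure fork tl-b
  ... | no a≢i   = tree-fork-edge-pure fork refl , a , a≢i , tl-a , tree-fork-edge-pure fork tl-a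

  tree-fork-¬ret-parent : ∀ v → IsTreeFork v → ¬ IsRetParent v
  tree-fork-¬ret-parent v (_ , tree-child) (_ , j , tl-j , ret) = tree-¬ret (tree-child j tl-j) ret

  IsTreeFork? : ∀ v → Dec (IsTreeFork v)
  IsTreeFork? v with IsInnerTree? efinite _≟V_ v
  ... | no ¬inner = no (¬inner ∘ proj₁)
  ... | yes inner with inner-cases v inner
  ...   | inj₁ fork      = yes fork
  ...   | inj₂ retParent = no (λ fork → tree-fork-¬ret-parent v fork retParent)

  inner-tree-vertices : Σ ℕ (IsCount (IsInnerTree G))
  inner-tree-vertices = IsCount-finite vfinite (IsInnerTree? efinite _≟V_)

  tree-forks : Σ ℕ (IsCount IsTreeFork)
  tree-forks = IsCount-finite vfinite IsTreeFork?

  #inner #forks : ℕ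
  #inner = proj₁ inner-tree-vertices
  #forks = proj₁ tree-forks

  roots : IsCount (IsRootV G) 1
  roots = IsCount-one root root-is root-unique

  EPS-count : IsCount (InEPS G) (#forks * 2)
  EPS-count = IsCount-cong tree-fork⇒EPS EPS⇒tree-fork
    (IsCount-preimage tl 2 (proj₂ tree-forks) (λ _ → proj₂ ∘ proj₁))

  tree-edges : IsCount (λ i → IsTreeV G (hd i)) (1 * 0 + (n * 1 + #inner * 1))
  tree-edges =
    IsCount-⊎ (IsCount-preimage hd 0 roots (λ _ → proj₁))
      (IsCount-⊎ (IsCount-preimage hd 1 leaves (λ _ → proj₁))
                 (IsCount-preimage hd 1 (proj₂ inner-tree-vertices) (λ _ → proj₁))
                 (λ _ → leaf-¬inner))
      (λ _ root → [ root-¬leaf root , root-¬inner root ])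

  module _ {r} (rets : IsCount (IsRet G) r) where

    ret-edges : IsCount (λ i → IsRet G (hd i)) (r * 2)
    ret-edges = IsCount-preimage hd 2 rets (λ _ → proj₁)

    ret-parents : IsCount IsRetParent (r * 2)
    ret-parents = IsCount-image (λ a _ → tl a) ret-edges
      (λ {a} {a'} ret ret' → ret-child-unique a a' ret ret')
      (λ a ret → ret-parent-inner a ret , a , refl , ret)
      (λ v (_ , j , tl-j , ret) → j , ret , λ _ → tl-j)

    inner-count : #inner ≡ #forks + r * 2
    inner-count = IsCount-unique (proj₂ inner-tree-vertices)
      (IsCount-cong (λ _ → [ proj₁ , proj₁ ]) inner-cases
        (IsCount-⊎ (proj₂ tree-forks) ret-parents tree-fork-¬ret-parent))

    private
      edges-by : (end : Edg → Vtx) → ∀ {d₀ d₁ d₂ d₃} →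
        (∀ v → IsRootV G v → IsCount (λ i → end i ≡ v) d₀) → (∀ v → IsLeaf G v → IsCount (λ i → end i ≡ v) d₁) →
        (∀ v → IsInnerTree G v → IsCount (λ i → end i ≡ v) d₂) → (∀ v → IsRet G v → IsCount (λ i → end i ≡ v) d₃) →
        IsCount {Edg} (λ _ → ⊤) (1 * d₀ + (n * d₁ + (#inner * d₂ + r * d₃)))
      edges-by end root leaf inner ret = IsCount-cong (λ _ _ → tt) (λ i _ → kinds (end i))
        (IsCount-⊎ (IsCount-preimage end _ roots root)
          (IsCount-⊎ (IsCount-preimage end _ leaves leaf)
            (IsCount-⊎ (IsCount-preimage end _ (proj₂ inner-tree-vertices) inner) (IsCount-preimage end _ rets ret)
              (λ _ → inner-¬ret))
            (λ _ leaf → [ leaf-¬inner leaf , leaf-¬ret leaf ]))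
          (λ _ root → [ root-¬leaf root , [ root-¬inner root , root-¬ret root ] ]))

    handshake : 1 * 0 + (n * 1 + (#inner * 1 + r * 2)) ≡ 1 * 1 + (n * 0 + (#inner * 2 + r * 1))
    handshake = IsCount-unique (edges-by hd (λ _ → proj₁) (λ _ → proj₁) (λ _ → proj₁) (λ _ → proj₁))
                               (edges-by tl (λ _ → proj₂) (λ _ → proj₂) (λ _ → proj₂) (λ _ → proj₂))

    leaf-count : n ≡ suc (#forks + r)
    leaf-count = +-cancelʳ-≡ (#forks + r * 4) n (suc (#forks + r)) (begin
      n + (#forks + r * 4)                                  ≡⟨ lhs n #forks r ⟩
      1 * 0 + (n * 1 + ((#forks + r * 2) * 1 + r * 2))      ≡⟨ cong (λ t → 1 * 0 + (n * 1 + (t * 1 + r * 2))) inner-count ⟨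
      1 * 0 + (n * 1 + (#inner * 1 + r * 2))                ≡⟨ handshake ⟩
      1 * 1 + (n * 0 + (#inner * 2 + r * 1))                ≡⟨ cong (λ t → 1 * 1 + (n * 0 + (t * 2 + r * 1))) inner-count ⟩
      1 * 1 + (n * 0 + ((#forks + r * 2) * 2 + r * 1))      ≡⟨ rhs n #forks r ⟩
      suc (#forks + r) + (#forks + r * 4)                   ∎)
      where
      open ≡-Reasoning
      lhs : ∀ n m r → n + (m + r * 4) ≡ 1 * 0 + (n * 1 + ((m + r * 2) * 1 + r * 2))
      lhs = ℕ-Solver.solve-∀
      rhs : ∀ n m r → 1 * 1 + (n * 0 + ((m + r * 2) * 2 + r * 1)) ≡ suc (m + r) + (m + r * 4)
      rhs = ℕ-Solver.solve-∀

module _ {A : Set} where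

  Finite-NewV : Finite A → Finite (NewV A)
  Finite-NewV = Finite-extend (λ { refl → refl }) (ins-u ∷ ins-v ∷ []) (((λ ()) ∷ []) ∷ [] ∷ [])
    (λ { _ (here ()) ; _ (there (here ())) })
    (λ { (oldV a) → inj₁ (a , refl) ; ins-u → inj₂ (here refl) ; ins-v → inj₂ (there (here refl)) })

  Finite-NewE : Finite A → Finite (NewE A)
  Finite-NewE = Finite-extend (λ { refl → refl }) (x₀ ∷ x₁ ∷ x₂ ∷ [])
    (((λ ()) ∷ (λ ()) ∷ []) ∷ ((λ ()) ∷ []) ∷ [] ∷ [])
    (λ { _ (here ()) ; _ (there (here ())) ; _ (there (there (here ()))) })
    (λ { (oldE a) → inj₁ (a , refl) ; x₀ → inj₂ (here refl) ; x₁ → inj₂ (there (here refl))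
       ; x₂ → inj₂ (there (there (here refl))) })

module SNPRPlusShape (N : FinGraph) (e f : Fin (FinGraph.E N)) where
  open FinGraph N

  G G⁺ : Graph
  G  = toGraph N
  G⁺ = snprPlus N e f

  tl⁺ hd⁺ : NewE (Fin E) → NewV (Fin V)
  tl⁺ = Graph.tl G⁺
  hd⁺ = Graph.hd G⁺

  data OldHead (i : Fin E) : NewV (Fin V) → Set where
    via-f : i ≡ f → OldHead i ins-u
    via-e : i ≢ f → i ≡ e → OldHead i ins-v
    kept  : i ≢ f → i ≢ e → OldHead i (oldV (hd i))

  old-head : ∀ i → OldHead i (hd⁺ (oldE i))
  old-head i with i ≟ f
  ... | yes i≡f = via-f i≡f
  ... | no i≢f with i ≟ e
  ...   | yes i≡e = via-e i≢f i≡e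
  ...   | no i≢e  = kept i≢f i≢e

  into-u : ∀ j → hd⁺ j ≡ ins-u → j ≡ oldE f
  into-u (oldE i) hd≡ with hd⁺ (oldE i) | old-head i
  ... | _ | via-f refl = refl
  into-u x₁ hd≡ with e ≟ f
  into-u x₁ () | yes _
  into-u x₁ () | no _

  out-of-u : ∀ j → tl⁺ j ≡ ins-u → j ≡ x₁ ⊎ j ≡ x₂
  out-of-u x₁ _ = inj₁ refl
  out-of-u x₂ _ = inj₂ refl

  out-of-v : ∀ j → tl⁺ j ≡ ins-v → j ≡ x₀
  out-of-v x₀ _ = refl

  out-of-old : ∀ j {w} → tl⁺ j ≡ oldV w → Σ (Fin E) λ i → j ≡ oldE i × tl i ≡ w
  out-of-old (oldE i) refl = i , refl , refl

  hd⁺-x₁-loop : e ≡ f → hd⁺ x₁ ≡ ins-v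
  hd⁺-x₁-loop e≡f with e ≟ f
  ... | yes _   = refl
  ... | no e≢f = ⊥-elim (e≢f e≡f)

  -- For f = e both children of u' are (parallel) edges into v', which is therefore no tree vertex.
  loop-¬tree-child : e ≡ f → ¬ IsTreeChild G⁺
  loop-¬tree-child e≡f tc⁺ with j , tl-j , tree ← tc⁺ ins-u (leaf-¬tail x₂ refl) with out-of-u j tl-j
  ... | inj₁ refl with () ← tree-in-unique {G = G⁺} {i = x₁} {j = x₂} tree refl (sym (hd⁺-x₁-loop e≡f))
  ... | inj₂ refl with () ← tree-in-unique {G = G⁺} {i = x₁} {j = x₂} tree (hd⁺-x₁-loop e≡f) refl

  hd⁺-f : hd⁺ (oldE f) ≡ ins-u
  hd⁺-f with hd⁺ (oldE f) | old-head f
  ... | _ | via-f _     = refl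
  ... | _ | via-e f≢f _ = ⊥-elim (f≢f refl)
  ... | _ | kept f≢f _  = ⊥-elim (f≢f refl)

  in-u : InDeg G⁺ ins-u 1
  in-u = IsCount-one (oldE f) hd⁺-f into-u

  out-u : OutDeg G⁺ ins-u 2
  out-u = IsCount-two x₁ x₂ refl refl (λ ()) out-of-u

  out-v : OutDeg G⁺ ins-v 1
  out-v = IsCount-one x₀ refl out-of-v

  module Proper (e≢f : e ≢ f) where

    hd⁺-x₁ : hd⁺ x₁ ≡ oldV (hd f)
    hd⁺-x₁ with e ≟ f
    ... | yes e≡f = ⊥-elim (e≢f e≡f)
    ... | no _    = refl

    hd⁺-e : hd⁺ (oldE e) ≡ ins-v
    hd⁺-e with hd⁺ (oldE e) | old-head e
    ... | _ | via-f e≡f  = ⊥-elim (e≢f e≡f)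
    ... | _ | via-e _ _  = refl
    ... | _ | kept _ e≢e = ⊥-elim (e≢e refl)

    into-v : ∀ j → hd⁺ j ≡ ins-v → j ≡ oldE e ⊎ j ≡ x₂
    into-v (oldE i) hd≡ with hd⁺ (oldE i) | old-head i
    ... | _ | via-e _ refl = inj₁ refl
    into-v x₁ hd≡ with () ← trans (sym hd⁺-x₁) hd≡
    into-v x₂ _ = inj₂ refl

    in-v : InDeg G⁺ ins-v 2
    in-v = IsCount-two (oldE e) x₂ hd⁺-e refl (λ ()) into-v

    redirect : Fin E → NewE (Fin E)
    redirect a with a ≟ e | a ≟ f
    ... | yes _ | _     = x₀
    ... | no _  | yes _ = x₁
    ... | no _  | no _  = oldE a

    unredirect : NewE (Fin E) → Fin E
    unredirect (oldE i) = i
    unredirect x₀       = e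
    unredirect x₁       = f
    unredirect x₂       = e

    unredirect-redirect : ∀ a → unredirect (redirect a) ≡ a
    unredirect-redirect a with a ≟ e | a ≟ f
    ... | yes refl | _        = refl
    ... | no _     | yes refl = refl
    ... | no _     | no _     = refl

    redirect-hd : ∀ a → hd⁺ (redirect a) ≡ oldV (hd a)
    redirect-hd a with a ≟ e | a ≟ f
    ... | yes refl | _        = refl
    ... | no _     | yes refl = hd⁺-x₁
    ... | no a≢e   | no a≢f with hd⁺ (oldE a) | old-head a
    ...   | _ | via-f a≡f   = ⊥-elim (a≢f a≡f)
    ...   | _ | via-e _ a≡e = ⊥-elim (a≢e a≡e)
    ...   | _ | kept _ _    = refl

    redirect-onto : ∀ j {w} → hd⁺ j ≡ oldV w → Σ (Fin E) λ a → hd a ≡ w × redirect a ≡ j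
    redirect-onto (oldE i) hd≡ with hd⁺ (oldE i) | old-head i
    ... | _ | kept i≢f i≢e = i , oldV-injective hd≡ , kept-redirect
      where
      oldV-injective : ∀ {a b : Fin V} → oldV a ≡ oldV b → a ≡ b
      oldV-injective refl = refl
      kept-redirect : redirect i ≡ oldE i
      kept-redirect with i ≟ e | i ≟ f
      ... | yes i≡e | _       = ⊥-elim (i≢e i≡e)
      ... | no _    | yes i≡f = ⊥-elim (i≢f i≡f)
      ... | no _    | no _    = refl
    redirect-onto x₀ refl = e , refl , e-redirect
      where
      e-redirect : redirect e ≡ x₀
      e-redirect with e ≟ e
      ... | yes _   = refl
      ... | no e≢e = ⊥-elim (e≢e refl)
    redirect-onto x₁ hd≡ with refl ← trans (sym hd⁺-x₁) hd≡ = f , refl , f-redirect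
      where
      f-redirect : redirect f ≡ x₁
      f-redirect with f ≟ e | f ≟ f
      ... | yes f≡e | _       = ⊥-elim (e≢f (sym f≡e))
      ... | no _    | yes _   = refl
      ... | no _    | no f≢f = ⊥-elim (f≢f refl)

    old-same-degrees : ∀ w → SameDegrees G w G⁺ (oldV w)
    old-same-degrees w = sameDegrees (in-degree {G = G} Finite-Fin _≟_ w) (out-degree {G = G} Finite-Fin _≟_ w)
      (λ _ ins → IsCount-image (λ a _ → redirect a) ins
        (λ {a} {a'} _ _ eq → trans (sym (unredirect-redirect a)) (trans (cong unredirect eq) (unredirect-redirect a')))
        (λ a hd≡ → trans (redirect-hd a) (cong oldV hd≡))
        (λ j hd≡ → let a , hd-a , red≡ = redirect-onto j hd≡ in a , hd-a , λ _ → red≡))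
      (λ _ outs → IsCount-image (λ a _ → oldE a) outs (λ { _ _ refl → refl }) (λ _ → cong oldV)
        (λ j tl≡ → let i , j≡ , tl-i = out-of-old j tl≡ in i , tl-i , λ _ → sym j≡))

  module Acyclicity (e≢f : e ≢ f) (acyclic : ∀ i → ¬ Reach G (hd i) (tl i)) (f∉desc : ¬ IsDescEdge G f e) where
    open Proper e≢f

    -- Contract u' to the tail of f and v' to the head of e; only the edge u' → v' has no image path.
    project : NewV (Fin V) → Fin V
    project (oldV w) = w
    project ins-u    = tl f
    project ins-v    = hd e

    project-edge : ∀ j → j ≢ x₂ → Reach G (project (tl⁺ j)) (project (hd⁺ j))
    project-edge (oldE i) _ with hd⁺ (oldE i) | old-head i
    ... | _ | via-f refl   = here
    ... | _ | via-e _ refl = Reach-edge e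
    ... | _ | kept _ _     = Reach-edge i
    project-edge x₀ _   = here
    project-edge x₁ _   = subst (Reach G (tl f) ∘ project) (sym hd⁺-x₁) (Reach-edge f)
    project-edge x₂ x₂≢ = ⊥-elim (x₂≢ refl)

    ViaCut : Fin V → Fin V → Set
    ViaCut a b = Reach G a b ⊎ (Reach G a (tl f) × Reach G (hd e) b)

    prepend : ∀ {a c b} → Reach G a c → ViaCut c b → ViaCut a b
    prepend r = Sum.map (Reach-trans r) (Product.map₁ (Reach-trans r))

    project-path : ∀ {a b} → Reach G⁺ a b → ViaCut (project a) (project b)
    project-path here = inj₁ here
    project-path (step x₂ refl q) = inj₂ (here , [ id , proj₂ ]′ (project-path q))
    project-path (step (oldE i) refl q) = prepend (project-edge (oldE i) (λ ())) (project-path q)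
    project-path (step x₀ refl q) = prepend (project-edge x₀ (λ ())) (project-path q)
    project-path (step x₁ refl q) = prepend (project-edge x₁ (λ ())) (project-path q)

    ¬reach-v→x : ∀ {a b} → project a ≡ hd e → project b ≡ tl f → ¬ Reach G⁺ a b
    ¬reach-v→x pa pb q with project-path q
    ... | inj₁ r       = f∉desc (subst₂ (Reach G) pa pb r)
    ... | inj₂ (r , _) = f∉desc (subst (λ z → Reach G z (tl f)) pa r)

    ¬reach-hd→tl : ∀ i {a b} → project a ≡ hd i → project b ≡ tl i → ¬ Reach G⁺ a b
    ¬reach-hd→tl i pa pb q with project-path q
    ... | inj₁ r        = acyclic i (subst₂ (Reach G) pa pb r)
    ... | inj₂ (r , r′) = f∉desc (Reach-trans (subst (Reach G (hd e)) pb r′)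
                                     (step i refl (subst (λ z → Reach G z (tl f)) pa r)))

    acyclic⁺ : ∀ j → ¬ Reach G⁺ (hd⁺ j) (tl⁺ j)
    acyclic⁺ (oldE i) c with hd⁺ (oldE i) | old-head i
    acyclic⁺ (oldE i) (step j tl-j q) | _ | via-f refl with out-of-u j tl-j
    ... | inj₁ refl = ¬reach-hd→tl f (cong project hd⁺-x₁) refl q
    ... | inj₂ refl = ¬reach-v→x refl refl q
    acyclic⁺ (oldE i) c | _ | via-e _ refl = ¬reach-hd→tl e refl refl c
    acyclic⁺ (oldE i) c | _ | kept _ _     = ¬reach-hd→tl i refl refl c
    acyclic⁺ x₀ c with Reach-last c
    ... | inj₂ (j , q , hd≡) with into-v j hd≡
    ...   | inj₁ refl = ¬reach-hd→tl e refl refl q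
    ...   | inj₂ refl = ¬reach-v→x refl refl q
    acyclic⁺ x₁ c = ¬reach-hd→tl f (cong project hd⁺-x₁) refl c
    acyclic⁺ x₂ c = ¬reach-v→x refl refl c

SNPRPlusTarget : (N : FinGraph) → Fin (FinGraph.E N) → Fin (FinGraph.E N) → Set
SNPRPlusTarget N e f = IsTreeEdge (toGraph N) f × f ≢ e × ¬ IsDescEdge (toGraph N) f e

module SNPRPlusCharacterisation {n} (N : FinGraph) (net : IsNetwork (toGraph N) n) (tc : IsTreeChild (toGraph N))
  (e f : Fin (FinGraph.E N)) where
  open FinGraph N
  open SNPRPlusShape N e f
  open TreeChildNetwork _≟_ _≟_ net tc using (¬ret⇒tree)

  module _ (e≢f : e ≢ f) where
    open Proper e≢f

    private
      back : ∀ {w} → IsTreeV G⁺ (oldV w) → IsTreeV G w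
      back = IsTreeV-transfer (SameDegrees-sym (old-same-degrees _))

      forth : ∀ {w} → IsTreeV G w → IsTreeV G⁺ (oldV w)
      forth = IsTreeV-transfer (old-same-degrees _)

      v-ret : IsRet G⁺ ins-v
      v-ret = in-v , out-v

      u-inner : IsInnerTree G⁺ ins-u
      u-inner = in-u , out-u

    tree-child⇒EPS×tree : IsTreeChild G⁺ → ¬ IsRet G (tl e) → InEPS G e × IsTreeEdge G f
    tree-child⇒EPS×tree tc⁺ ¬ret = ((tree-u , tree-v) , sibling) , tree-y
      where
      tree-u : IsTreeV G (tl e)
      tree-u = ¬ret⇒tree (tl e) ¬ret

      tree-tail : ∀ {i} → tl i ≡ tl e → IsTreeV G (tl i)
      tree-tail tl-i = subst (IsTreeV G) (sym tl-i) tree-u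

      tree-y : IsTreeV G (hd f)
      tree-y with j , tl-j , tree ← tc⁺ ins-u (leaf-¬tail x₂ refl) with out-of-u j tl-j
      ... | inj₁ refl = back (subst (IsTreeV G⁺) hd⁺-x₁ tree)
      ... | inj₂ refl = ⊥-elim (tree-¬ret tree v-ret)

      tree-v : IsTreeV G (hd e)
      tree-v with j , tl-j , tree ← tc⁺ ins-v (leaf-¬tail x₀ refl) with refl ← out-of-v j tl-j = back tree

      sibling : Σ (Fin E) λ g → g ≢ e × tl g ≡ tl e × IsPureTreeEdge G g
      sibling with j , tl-j , tree ← tc⁺ (oldV (tl e)) (leaf-¬tail (oldE e) refl)
        with i , refl , tl-i ← out-of-old j tl-j
        with hd⁺ (oldE i) | old-head i
      ... | _ | via-f refl   = f , e≢f ∘ sym , tl-i , tree-tail tl-i , tree-y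
      ... | _ | via-e _ refl = ⊥-elim (tree-¬ret tree v-ret)
      ... | _ | kept _ i≢e   = i , i≢e , tl-i , tree-tail tl-i , back tree

    module _ (eps : InEPS G e) (tree-y : IsTreeEdge G f) (f∉desc : ¬ IsDescEdge G f e) where
      open IsNetwork net
      open Acyclicity e≢f acyclic f∉desc using (acyclic⁺)

      private
        new-¬root : ∀ {w} → IsRootV G⁺ w → w ≡ ins-u ⊎ w ≡ ins-v → ⊥
        new-¬root (in₀ , _) (inj₁ refl) with () ← IsCount-unique in₀ in-u
        new-¬root (in₀ , _) (inj₂ refl) with () ← IsCount-unique in₀ in-v

        new-¬leaf : ∀ {w} → IsLeaf G⁺ w → w ≡ ins-u ⊎ w ≡ ins-v → ⊥
        new-¬leaf (_ , out₀) (inj₁ refl) with () ← IsCount-unique out₀ out-u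
        new-¬leaf (in₁ , _)  (inj₂ refl) with () ← IsCount-unique in₁ in-v

      network⁺ : IsNetwork G⁺ n
      network⁺ = record
        { vfinite     = Finite-NewV vfinite
        ; efinite     = Finite-NewE efinite
        ; acyclic     = acyclic⁺
        ; root        = oldV root
        ; root-is     = degrees-transfer (old-same-degrees root) root-is
        ; root-unique = λ where
            (oldV w) root⁺ → cong oldV (root-unique w (degrees-transfer (SameDegrees-sym (old-same-degrees w)) root⁺))
            ins-u root⁺ → ⊥-elim (new-¬root root⁺ (inj₁ refl))
            ins-v root⁺ → ⊥-elim (new-¬root root⁺ (inj₂ refl))
        ; kinds       = λ where
            (oldV w) → kind-transfer (old-same-degrees w) (kinds w)
            ins-u    → inj₂ (inj₂ (inj₁ u-inner))
            ins-v    → inj₂ (inj₂ (inj₂ v-ret))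
        ; leaves      = IsCount-image (λ w _ → oldV w) leaves (λ { _ _ refl → refl })
            (λ w → degrees-transfer (old-same-degrees w))
            (λ where
              (oldV w) leaf⁺ → w , degrees-transfer (SameDegrees-sym (old-same-degrees w)) leaf⁺ , λ _ → refl
              ins-u leaf⁺ → ⊥-elim (new-¬leaf leaf⁺ (inj₁ refl))
              ins-v leaf⁺ → ⊥-elim (new-¬leaf leaf⁺ (inj₂ refl)))
        }

      tree-child⁺ : IsTreeChild G⁺
      tree-child⁺ ins-u _ = x₁ , refl , subst (IsTreeV G⁺) (sym hd⁺-x₁) (forth tree-y)
      tree-child⁺ ins-v _ = x₀ , refl , forth (proj₂ (proj₁ eps))
      tree-child⁺ (oldV w) ¬leaf with i , refl , tree ← tc w (¬leaf ∘ degrees-transfer (old-same-degrees w))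
        with hd⁺ (oldE i) in hd≡ | old-head i
      ... | _ | via-f refl   = oldE f , refl , subst (IsTreeV G⁺) (sym hd≡) (inj₂ (inj₂ u-inner))
      ... | _ | kept _ _     = oldE i , refl , subst (IsTreeV G⁺) (sym hd≡) (forth tree)
      ... | _ | via-e _ refl with g , g≢e , tl-g , (_ , tree-g) ← proj₂ eps
        with hd⁺ (oldE g) in hd≡′ | old-head g
      ...   | _ | via-f refl  = oldE f , cong oldV tl-g , subst (IsTreeV G⁺) (sym hd≡′) (inj₂ (inj₂ u-inner))
      ...   | _ | via-e _ g≡e = ⊥-elim (g≢e g≡e)
      ...   | _ | kept _ _    = oldE g , cong oldV tl-g , subst (IsTreeV G⁺) (sym hd≡′) (forth tree-g)

  respecting⇔EPS×target : SNPRPlusRespecting n N (e , f) ⇔ (InEPS G e × SNPRPlusTarget N e f)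
  respecting⇔EPS×target = mk⇔ respecting⇒ ⇒respecting
    where
    respecting⇒ : SNPRPlusRespecting n N (e , f) → InEPS G e × SNPRPlusTarget N e f
    respecting⇒ (¬ret , f∉desc , _ , tc⁺) with e ≟ f
    ... | yes e≡f = ⊥-elim (loop-¬tree-child e≡f tc⁺)
    ... | no e≢f  = let eps , tree-y = tree-child⇒EPS×tree e≢f tc⁺ ¬ret in eps , tree-y , e≢f ∘ sym , f∉desc

    ⇒respecting : InEPS G e × SNPRPlusTarget N e f → SNPRPlusRespecting n N (e , f)
    ⇒respecting (eps , tree-y , f≢e , f∉desc) =
      tree-¬ret (proj₁ (proj₁ eps)) , f∉desc , network⁺ (f≢e ∘ sym) eps tree-y f∉desc , tree-child⁺ (f≢e ∘ sym) eps tree-y f∉desc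

-- The hypothesis sums δ_T(e) + 1 + (number of targets of e) = (number of tree edges) over the 2m edges of E_PS.
snpr⁺-sum : ∀ {n m r t k s} → n ≡ suc (m + r) → t ≡ m + r * 2 →
  s + (m * 2 + k) ≡ m * 2 * (1 * 0 + (n * 1 + t * 1)) → k + s ≡ (m * 2) * (m * 2 + r * 3)
snpr⁺-sum {m = m} {r} {k = k} {s} refl refl eq = +-cancelʳ-≡ (m * 2) (k + s) _ (begin
  k + s + m * 2                                                  ≡⟨ lhs k s m ⟩
  s + (m * 2 + k)                                                ≡⟨ eq ⟩
  m * 2 * (1 * 0 + (suc (m + r) * 1 + (m + r * 2) * 1))          ≡⟨ rhs m r ⟩
  (m * 2) * (m * 2 + r * 3) + m * 2                              ∎)
  where
  open ≡-Reasoning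
  lhs : ∀ k s m → k + s + m * 2 ≡ s + (m * 2 + k)
  lhs = ℕ-Solver.solve-∀
  rhs : ∀ m r → m * 2 * (1 * 0 + (suc (m + r) * 1 + (m + r * 2) * 1)) ≡ (m * 2) * (m * 2 + r * 3) + m * 2
  rhs = ℕ-Solver.solve-∀

snpr⁺-formula : ∀ {n m r k s} → n ≡ suc (m + r) → k + s ≡ (m * 2) * (m * 2 + r * 3) →
  + k ≡ + 4 *ℤ + n *ℤ + n -ℤ + 2 *ℤ + n *ℤ + r -ℤ + 8 *ℤ + n
        -ℤ + 2 *ℤ + r *ℤ + r +ℤ + 2 *ℤ + r +ℤ + 4 -ℤ + s
snpr⁺-formula {m = m} {r} {k} {s} refl k+s≡ = begin
  + k                                                 ≡⟨ add-sub (+ k) (+ s) ⟩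
  (+ k +ℤ + s) -ℤ + s                                 ≡⟨ cong (_-ℤ + s) k+s≡ℤ ⟩
  (+ m *ℤ + 2) *ℤ (+ m *ℤ + 2 +ℤ + r *ℤ + 3) -ℤ + s  ≡⟨ polynomial (+ m) (+ r) (+ s) ⟩
  _                                                   ∎
  where
  open ≡-Reasoning
  add-sub : ∀ K S → K ≡ (K +ℤ S) -ℤ S
  add-sub = ℤ-Solver.solve-∀
  k+s≡ℤ : + k +ℤ + s ≡ (+ m *ℤ + 2) *ℤ (+ m *ℤ + 2 +ℤ + r *ℤ + 3)
  k+s≡ℤ = begin
    + k +ℤ + s                           ≡⟨ ℤ.pos-+ k s ⟨
    + (k + s)                            ≡⟨ cong +_ k+s≡ ⟩
    + ((m * 2) * (m * 2 + r * 3))        ≡⟨ ℤ.pos-* (m * 2) _ ⟩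
    + (m * 2) *ℤ + (m * 2 + r * 3)       ≡⟨ cong₂ _*ℤ_ (ℤ.pos-* m 2) (ℤ.pos-+ (m * 2) (r * 3)) ⟩
    (+ m *ℤ + 2) *ℤ (+ (m * 2) +ℤ + (r * 3)) ≡⟨ cong (λ z → (+ m *ℤ + 2) *ℤ z) (cong₂ _+ℤ_ (ℤ.pos-* m 2) (ℤ.pos-* r 3)) ⟩
    (+ m *ℤ + 2) *ℤ (+ m *ℤ + 2 +ℤ + r *ℤ + 3) ∎
  -- + suc (m + r) is definitionally + 1 +ℤ (+ m +ℤ + r), so the solver sees n as a polynomial in m and r.
  polynomial : ∀ M R S → (M *ℤ + 2) *ℤ (M *ℤ + 2 +ℤ R *ℤ + 3) -ℤ S ≡
    + 4 *ℤ (+ 1 +ℤ (M +ℤ R)) *ℤ (+ 1 +ℤ (M +ℤ R)) -ℤ + 2 *ℤ (+ 1 +ℤ (M +ℤ R)) *ℤ R -ℤ + 8 *ℤ (+ 1 +ℤ (M +ℤ R))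
      -ℤ + 2 *ℤ R *ℤ R +ℤ + 2 *ℤ R +ℤ + 4 -ℤ S
  polynomial = ℤ-Solver.solve-∀

module SNPRPlusCount {n} (N : FinGraph) (net : IsNetwork (toGraph N) n) (tc : IsTreeChild (toGraph N)) where
  open FinGraph N
  open IsNetwork net
  open TreeChildNetwork _≟_ _≟_ net tc

  G : Graph
  G = toGraph N

  open Reachability G _≟_ vfinite efinite acyclic using (Reach?)

  targets : ∀ e → Σ ℕ (IsCount (SNPRPlusTarget N e))
  targets e = IsCount-finite efinite (λ f → IsTreeV? efinite _≟_ (hd f) ×-dec ¬? (f ≟ e) ×-dec ¬? (Reach? (hd e) (tl f)))

  #targets : Fin E → ℕ
  #targets e = proj₁ (targets e)

  tree-edge-split : ∀ e → IsTreeEdge G e → ∀ {d} → DeltaT G e d →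
    1 * 0 + (n * 1 + #inner * 1) ≡ d + suc (#targets e)
  tree-edge-split e tree-e Δ = IsCount-unique tree-edges
    (IsCount-cong (λ f → [ proj₂ , [ proj₂ , proj₁ ] ]) cases
      (IsCount-⊎ Δ (IsCount-⊎ itself (proj₂ (targets e)) (λ { f (refl , _) (_ , f≢e , _) → f≢e refl }))
        (λ { f (desc , _) (inj₁ (refl , _)) → acyclic f desc ; f (desc , _) (inj₂ (_ , _ , ¬desc)) → ¬desc desc })))
    where
    itself : IsCount (λ f → f ≡ e × IsTreeEdge G f) 1
    itself = IsCount-one e (refl , tree-e) (λ _ → proj₁)

    cases : ∀ f → IsTreeEdge G f → (IsDescEdge G f e × IsTreeEdge G f) ⊎ ((f ≡ e × IsTreeEdge G f) ⊎ SNPRPlusTarget N e f)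
    cases f tree-f with f ≟ e | Reach? (hd e) (tl f)
    ... | yes f≡e | _       = inj₂ (inj₁ (f≡e , tree-f))
    ... | no _    | yes desc = inj₁ (desc , tree-f)
    ... | no f≢e  | no ¬desc = inj₂ (inj₂ (tree-f , f≢e , ¬desc))

  private
    targets-sum : Σ ℕ (SumOver (InEPS G) #targets)
    targets-sum = SumOver-exists EPS-count #targets

  #respecting : ℕ
  #respecting = proj₁ targets-sum

  respecting-count : IsCount (SNPRPlusRespecting n N) #respecting
  respecting-count = IsCount-cong (λ (e , f) → from (characterisation e f)) (λ (e , f) → to (characterisation e f))
    (IsCount-Σ (SNPRPlusTarget N) (proj₂ targets-sum) (λ e _ → proj₂ (targets e)))
    where
    characterisation : ∀ e f → SNPRPlusRespecting n N (e , f) ⇔ (InEPS G e × SNPRPlusTarget N e f)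
    characterisation = SNPRPlusCharacterisation.respecting⇔EPS×target N net tc

  respecting-formula : ∀ {r} → IsCount (IsRet G) r → (δ : Fin E → ℕ) (s : ℕ) →
    (∀ e → DeltaT G e (δ e)) → SumOver (InEPS G) δ s →
    + #respecting ≡ + 4 *ℤ + n *ℤ + n -ℤ + 2 *ℤ + n *ℤ + r -ℤ + 8 *ℤ + n
                    -ℤ + 2 *ℤ + r *ℤ + r +ℤ + 2 *ℤ + r +ℤ + 4 -ℤ + s
  respecting-formula rets δ s Δ Σδ = snpr⁺-formula (leaf-count rets) (snpr⁺-sum {m = #forks} {t = #inner} {k = #respecting} {s = s} (leaf-count rets) (inner-count rets)
    (SumOver-complementary _ (λ e eps → sym (tree-edge-split e (proj₂ (proj₁ eps)) (Δ e)))
      Σδ (SumOver-suc EPS-count (proj₂ targets-sum)) EPS-count))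

Σ-T-≡ : ∀ {A : Set} {g : A → Bool} {a b : A} {p : T (g a)} {q : T (g b)} →
  a ≡ b → _≡_ {A = Σ A (T ∘ g)} (a , p) (b , q)
Σ-T-≡ {p = p} {q} refl = cong (_ ,_) (T-irrelevant p q)

module SNPRMinusShape {n} (N : FinGraph) (net : IsNetwork (toGraph N) n) (tc : IsTreeChild (toGraph N))
  (e : Fin (FinGraph.E N)) (ret : IsRet (toGraph N) (FinGraph.hd N e)) where
  open FinGraph N
  open IsNetwork net
  open TreeChildNetwork _≟_ _≟_ net tc using (ret-parent-inner)

  G : Graph
  G = toGraph N

  u v : Fin V
  u = tl e
  v = hd e

  inner-u : IsInnerTree G u
  inner-u = ret-parent-inner e ret

  other : ∀ {P : Fin E → Set} → IsCount P 2 → P e → Σ (Fin E) λ j → P j × j ≢ e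
  other two pe with a , b , pa , pb , a≢b ← IsCount-two⇒∃ two | a ≟ e
  ... | yes refl = b , pb , a≢b ∘ sym
  ... | no a≢e   = a , pa , a≢e

  -- Kept opaque so that the choice of edges does not unfold into later goals.
  opaque
    sibling-edge : Σ (Fin E) λ j → tl j ≡ u × j ≢ e
    sibling-edge = other (proj₂ inner-u) refl

    other-parent-edge : Σ (Fin E) λ j → hd j ≡ v × j ≢ e
    other-parent-edge = other (proj₁ ret) refl

    child-edge : Σ (Fin E) λ j → tl j ≡ v
    child-edge = IsCount-one⇒∃ (proj₂ ret)

    parent-edge : Σ (Fin E) λ j → hd j ≡ u
    parent-edge = IsCount-one⇒∃ (proj₁ inner-u)

  -- With e = (u, v): the edges cu = (u, x) and cv = (v, c) are deleted together with e, and the remaining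
  -- parent edges pu of u and wv of v are redirected to x and c.
  cu cv pu wv : Fin E
  cu = proj₁ sibling-edge
  cv = proj₁ child-edge
  pu = proj₁ parent-edge
  wv = proj₁ other-parent-edge

  tl-cu : tl cu ≡ u
  tl-cu = proj₁ (proj₂ sibling-edge)

  cu≢e : cu ≢ e
  cu≢e = proj₂ (proj₂ sibling-edge)

  tl-cv : tl cv ≡ v
  tl-cv = proj₂ child-edge

  hd-pu : hd pu ≡ u
  hd-pu = proj₂ parent-edge

  hd-wv : hd wv ≡ v
  hd-wv = proj₁ (proj₂ other-parent-edge)

  wv≢e : wv ≢ e
  wv≢e = proj₂ (proj₂ other-parent-edge)

  x c : Fin V
  x = hd cu
  c = hd cv

  out-of-u : ∀ j → tl j ≡ u → j ≡ e ⊎ j ≡ cu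
  out-of-u j = IsCount-two⇒≡⊎≡ (proj₂ inner-u) refl tl-cu (cu≢e ∘ sym)

  out-of-v : ∀ j → tl j ≡ v → j ≡ cv
  out-of-v j tl-j = IsCount-one⇒≡ (proj₂ ret) tl-j tl-cv

  into-u : ∀ j → hd j ≡ u → j ≡ pu
  into-u j hd-j = IsCount-one⇒≡ (proj₁ inner-u) hd-j hd-pu

  into-v : ∀ j → hd j ≡ v → j ≡ e ⊎ j ≡ wv
  into-v j = IsCount-two⇒≡⊎≡ (proj₁ ret) refl hd-wv (wv≢e ∘ sym)

  tree-x : IsTreeV G x
  tree-x with j , tl-j , tree ← tc u (leaf-¬tail e refl) with out-of-u j tl-j
  ... | inj₁ refl = ⊥-elim (tree-¬ret tree ret)
  ... | inj₂ refl = tree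

  tree-c : IsTreeV G c
  tree-c with j , tl-j , tree ← tc v (leaf-¬tail cv tl-cv) with refl ← out-of-v j tl-j = tree

  v≢u : v ≢ u
  v≢u v≡u = acyclic e (subst (Reach G v) v≡u here)

  x≢u : x ≢ u
  x≢u x≡u = acyclic cu (subst (Reach G x) (trans x≡u (sym tl-cu)) here)

  x≢v : x ≢ v
  x≢v x≡v = tree-¬ret (subst (IsTreeV G) x≡v tree-x) ret

  c≢u : c ≢ u
  c≢u c≡u = acyclic e (step cv tl-cv (subst (Reach G c) c≡u here))

  c≢v : c ≢ v
  c≢v c≡v = acyclic cv (subst (Reach G c) (trans c≡v (sym tl-cv)) here)

  open SNPRMinus N e cu cv using (keepV; fv; fu; keepE; result)

  R : Graph
  R = result

  data Merged (w : Fin V) : Fin V → Set where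
    at-u : w ≡ u → Merged w x
    at-v : w ≡ v → Merged w c
    kept : w ≢ u → w ≢ v → Merged w w

  merged : ∀ w → Merged w (fu w)
  merged w with w ≟ u
  ... | yes w≡u with x ≟ v
  ...   | yes x≡v = ⊥-elim (x≢v x≡v)
  ...   | no _    = at-u w≡u
  merged w | no w≢u with w ≟ v
  ...   | yes w≡v = at-v w≡v
  ...   | no w≢v  = kept w≢u w≢v

  keepV-intro : ∀ {w} → w ≢ u → w ≢ v → T (keepV w)
  keepV-intro {w} w≢u w≢v with w ≟ u | w ≟ v
  ... | yes w≡u | _       = w≢u w≡u
  ... | no _    | yes w≡v = w≢v w≡v
  ... | no _    | no _    = tt

  keepV-elim : ∀ {w} → T (keepV w) → w ≢ u × w ≢ v
  keepV-elim {w} kw with w ≟ u | w ≟ v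
  ... | no w≢u | no w≢v = w≢u , w≢v

  merged-kept : ∀ w → T (keepV (fu w))
  merged-kept w with fu w | merged w
  ... | _ | at-u _       = keepV-intro x≢u x≢v
  ... | _ | at-v _       = keepV-intro c≢u c≢v
  ... | _ | kept w≢u w≢v = keepV-intro w≢u w≢v

  keepE-intro : ∀ {i} → i ≢ e → i ≢ cu → i ≢ cv → T (keepE i)
  keepE-intro {i} i≢e i≢cu i≢cv with i ≟ e | i ≟ cu | i ≟ cv
  ... | yes i≡e | _        | _        = i≢e i≡e
  ... | no _    | yes i≡cu | _        = i≢cu i≡cu
  ... | no _    | no _     | yes i≡cv = i≢cv i≡cv
  ... | no _    | no _     | no _     with tl i ≟ u | tl i ≟ v
  ...   | yes tl≡u | _       = [ i≢e , i≢cu ] (out-of-u i tl≡u)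
  ...   | no _     | yes tl≡v = i≢cv (out-of-v i tl≡v)
  ...   | no _     | no _     = merged-kept (hd i)

  keepE-elim : ∀ {i} → T (keepE i) → i ≢ e × i ≢ cu × i ≢ cv
  keepE-elim {i} ki with i ≟ e | i ≟ cu | i ≟ cv
  ... | no i≢e | no i≢cu | no i≢cv = i≢e , i≢cu , i≢cv

  Kept : Set
  Kept = Σ (Fin V) (T ∘ keepV)


  hd≢ : ∀ {i j} → hd i ≢ hd j → i ≢ j
  hd≢ hd≢hd refl = hd≢hd refl

  fu-u : fu u ≡ x
  fu-u with fu u | merged u
  ... | _ | at-u _     = refl
  ... | _ | at-v v≡u   = ⊥-elim (v≢u (sym v≡u))
  ... | _ | kept u≢u _ = ⊥-elim (u≢u refl)

  fu-v : fu v ≡ c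
  fu-v with fu v | merged v
  ... | _ | at-u v≡u   = ⊥-elim (v≢u v≡u)
  ... | _ | at-v _     = refl
  ... | _ | kept _ v≢v = ⊥-elim (v≢v refl)

  fu-kept : ∀ {w} → w ≢ u → w ≢ v → fu w ≡ w
  fu-kept {w} w≢u w≢v with fu w | merged w
  ... | _ | at-u w≡u = ⊥-elim (w≢u w≡u)
  ... | _ | at-v w≡v = ⊥-elim (w≢v w≡v)
  ... | _ | kept _ _ = refl

  pu≢e : pu ≢ e
  pu≢e = hd≢ (λ h → v≢u (trans (sym h) hd-pu))

  pu≢cu : pu ≢ cu
  pu≢cu = hd≢ (λ h → x≢u (trans (sym h) hd-pu))

  pu≢cv : pu ≢ cv
  pu≢cv = hd≢ (λ h → c≢u (trans (sym h) hd-pu))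

  pu≢wv : pu ≢ wv
  pu≢wv = hd≢ (λ h → v≢u (trans (sym hd-wv) (trans (sym h) hd-pu)))

  wv≢cu : wv ≢ cu
  wv≢cu = hd≢ (λ h → x≢v (trans (sym h) hd-wv))

  wv≢cv : wv ≢ cv
  wv≢cv = hd≢ (λ h → c≢v (trans (sym h) hd-wv))

  cu≢cv : cu ≢ cv
  cu≢cv cu≡cv = v≢u (trans (sym tl-cv) (trans (cong tl (sym cu≡cv)) tl-cu))

  replace : Fin E → Fin E
  replace a with a ≟ cu | a ≟ cv
  ... | yes _ | _     = pu
  ... | no _  | yes _ = wv
  ... | no _  | no _  = a

  data Replaced (a : Fin E) : Fin E → Set where
    of-cu : a ≡ cu → Replaced a pu
    of-cv : a ≡ cv → Replaced a wv
    same  : a ≢ cu → a ≢ cv → Replaced a a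

  replaced : ∀ a → Replaced a (replace a)
  replaced a with a ≟ cu | a ≟ cv
  ... | yes a≡cu | _        = of-cu a≡cu
  ... | no _     | yes a≡cv = of-cv a≡cv
  ... | no a≢cu  | no a≢cv  = same a≢cu a≢cv

  unreplace : Fin E → Fin E
  unreplace i with i ≟ pu | i ≟ wv
  ... | yes _ | _     = cu
  ... | no _  | yes _ = cv
  ... | no _  | no _  = i

  unreplace-replace : ∀ a → hd a ≢ u → hd a ≢ v → unreplace (replace a) ≡ a
  unreplace-replace a hd≢u hd≢v with replace a | replaced a
  ... | _ | of-cu refl with pu ≟ pu
  ...   | yes _   = refl
  ...   | no pu≢pu = ⊥-elim (pu≢pu refl)
  unreplace-replace a hd≢u hd≢v | _ | of-cv refl with wv ≟ pu | wv ≟ wv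
  ...   | yes wv≡pu | _        = ⊥-elim (pu≢wv (sym wv≡pu))
  ...   | no _      | yes _    = refl
  ...   | no _      | no wv≢wv = ⊥-elim (wv≢wv refl)
  unreplace-replace a hd≢u hd≢v | _ | same _ _ with a ≟ pu | a ≟ wv
  ...   | yes refl | _        = ⊥-elim (hd≢u hd-pu)
  ...   | no _     | yes refl = ⊥-elim (hd≢v hd-wv)
  ...   | no _     | no _     = refl

  module _ {w} (w≢u : w ≢ u) (w≢v : w ≢ v) where

    replace-kept : ∀ a → hd a ≡ w → T (keepE (replace a))
    replace-kept a hd-a with replace a | replaced a
    ... | _ | of-cu _         = keepE-intro pu≢e pu≢cu pu≢cv
    ... | _ | of-cv _         = keepE-intro wv≢e wv≢cu wv≢cv
    ... | _ | same a≢cu a≢cv  = keepE-intro (hd≢ (λ h → w≢v (trans (sym hd-a) h))) a≢cu a≢cv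

    replace-hd : ∀ a → hd a ≡ w → fu (hd (replace a)) ≡ w
    replace-hd a hd-a with replace a | replaced a
    ... | _ | of-cu refl = trans (cong fu hd-pu) (trans fu-u hd-a)
    ... | _ | of-cv refl = trans (cong fu hd-wv) (trans fu-v hd-a)
    ... | _ | same _ _   = trans (cong fu hd-a) (fu-kept w≢u w≢v)

    replace-onto : ∀ i → T (keepE i) → fu (hd i) ≡ w → Σ (Fin E) λ a → hd a ≡ w × replace a ≡ i
    replace-onto i ki fu≡w with keepE-elim ki | hd i ≟ u | hd i ≟ v
    ... | _ | yes hd≡u | _ with refl ← into-u i hd≡u = cu , trans (sym (trans (cong fu hd-pu) fu-u)) fu≡w , replace-cu
      where
      replace-cu : replace cu ≡ pu
      replace-cu with replace cu | replaced cu
      ... | _ | of-cu _       = refl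
      ... | _ | of-cv cu≡cv   = ⊥-elim (cu≢cv cu≡cv)
      ... | _ | same cu≢cu _  = ⊥-elim (cu≢cu refl)
    ... | i≢e , _ , _ | no _ | yes hd≡v with into-v i hd≡v
    ...   | inj₁ i≡e  = ⊥-elim (i≢e i≡e)
    ...   | inj₂ refl = cv , trans (sym (trans (cong fu hd-wv) fu-v)) fu≡w , replace-cv
      where
      replace-cv : replace cv ≡ wv
      replace-cv with replace cv | replaced cv
      ... | _ | of-cu cv≡cu  = ⊥-elim (cu≢cv (sym cv≡cu))
      ... | _ | of-cv _      = refl
      ... | _ | same _ cv≢cv = ⊥-elim (cv≢cv refl)
    replace-onto i ki fu≡w | _ , i≢cu , i≢cv | no hd≢u | no hd≢v = i , trans (sym (fu-kept hd≢u hd≢v)) fu≡w , replace-same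
      where
      replace-same : replace i ≡ i
      replace-same with replace i | replaced i
      ... | _ | of-cu i≡cu = ⊥-elim (i≢cu i≡cu)
      ... | _ | of-cv i≡cv = ⊥-elim (i≢cv i≡cv)
      ... | _ | same _ _   = refl

    kept-same-degrees : (kw : T (keepV w)) → SameDegrees G w R (w , kw)
    kept-same-degrees kw = sameDegrees (in-degree {G = G} Finite-Fin _≟_ w) (out-degree {G = G} Finite-Fin _≟_ w)
      (λ _ ins → IsCount-image (λ a hd-a → replace a , replace-kept a hd-a) ins
        (λ {a} {a'} hd-a hd-a' eq → trans (sym (uncurry (unreplace-replace a) (not-deleted hd-a)))
          (trans (cong (unreplace ∘ proj₁) eq) (uncurry (unreplace-replace a') (not-deleted hd-a'))))
        (λ a hd-a → Σ-T-≡ (replace-hd a hd-a))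
        (λ (i , ki) hd≡ → let a , hd-a , replace≡ = replace-onto i ki (cong proj₁ hd≡) in a , hd-a , λ _ → Σ-T-≡ replace≡))
      (λ _ outs → IsCount-image keep-out outs
        (λ { _ _ refl → refl }) (λ a tl-a → Σ-T-≡ tl-a)
        (λ (i , ki) tl≡ → i , cong proj₁ tl≡ , λ _ → Σ-T-≡ refl))
      where
      out-edge≢ : ∀ {a j} → tl a ≡ w → tl j ≡ u → a ≢ j
      out-edge≢ tl-a tl-j refl = w≢u (trans (sym tl-a) tl-j)
      keep-out : ∀ a → tl a ≡ w → Graph.Edg R
      keep-out a tl-a = a , keepE-intro (out-edge≢ tl-a refl) (out-edge≢ tl-a tl-cu) (λ { refl → w≢v (trans (sym tl-a) tl-cv) })
      not-deleted : ∀ {a} → hd a ≡ w → hd a ≢ u × hd a ≢ v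
      not-deleted hd-a = (λ h → w≢u (trans (sym hd-a) h)) , (λ h → w≢v (trans (sym hd-a) h))

  same-degrees : ∀ (w : Kept) → SameDegrees G (proj₁ w) R w
  same-degrees (w , kw) = uncurry kept-same-degrees (keepV-elim kw) kw

  same-degrees⁻ : ∀ (w : Kept) → SameDegrees R w G (proj₁ w)
  same-degrees⁻ = SameDegrees-sym ∘ same-degrees

  into-merged : ∀ w → Reach G w (fu w)
  into-merged w with fu w | merged w
  ... | _ | at-u refl = step cu tl-cu here
  ... | _ | at-v refl = step cv tl-cv here
  ... | _ | kept _ _  = here

  project-path : ∀ {a b} → Reach R a b → Reach G (proj₁ a) (proj₁ b)
  project-path here                    = here
  project-path (step (i , _) refl q) = step i refl (Reach-trans (into-merged (hd i)) (project-path q))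

  acyclic-R : ∀ j → ¬ Reach R (Graph.hd R j) (Graph.tl R j)
  acyclic-R (i , _) cycle = acyclic i (Reach-trans (into-merged (hd i)) (project-path cycle))

  keep-¬inner-¬ret : ∀ w → ¬ IsInnerTree G w → ¬ IsRet G w → T (keepV w)
  keep-¬inner-¬ret w ¬inner ¬ret = keepV-intro {w} (λ { refl → ¬inner inner-u }) (λ { refl → ¬ret ret })

  network-R : IsNetwork R n
  network-R = record
    { vfinite     = Finite-Σ T-irrelevant (T? ∘ keepV) vfinite
    ; efinite     = Finite-Σ T-irrelevant (T? ∘ keepE) efinite
    ; acyclic     = acyclic-R
    ; root        = root , root-kept
    ; root-is     = degrees-transfer (same-degrees (root , root-kept)) root-is
    ; root-unique = λ w root′ → Σ-T-≡ (root-unique (proj₁ w) (degrees-transfer (same-degrees⁻ w) root′))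
    ; kinds       = λ w → kind-transfer (same-degrees w) (kinds (proj₁ w))
    ; leaves      = IsCount-image (λ w leaf → w , leaf-kept leaf) leaves (λ { _ _ refl → refl })
        (λ w leaf → degrees-transfer (same-degrees (w , leaf-kept leaf)) leaf)
        (λ w leaf → proj₁ w , degrees-transfer (same-degrees⁻ w) leaf , λ _ → Σ-T-≡ refl)
    }
    where
    root-kept : T (keepV root)
    root-kept = keep-¬inner-¬ret root (root-¬inner root-is) (root-¬ret root-is)
    leaf-kept : ∀ {w} → IsLeaf G w → T (keepV w)
    leaf-kept leaf = keep-¬inner-¬ret _ (leaf-¬inner leaf) (leaf-¬ret leaf)

  tree-child-R : IsTreeChild R
  tree-child-R (w , kw) ¬leaf with i , refl , tree ← tc w (¬leaf ∘ degrees-transfer (same-degrees (w , kw)))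
    with keepV-elim {tl i} kw
  ... | w≢u , w≢v = (i , ki) , Σ-T-≡ refl , tree-head (merged (hd i))
    where
    ki : T (keepE i)
    ki = keepE-intro {i} (λ { refl → w≢u refl }) (λ { refl → w≢u tl-cu }) (λ { refl → w≢v tl-cv })
    tree-head : ∀ {w′} → Merged (hd i) w′ → {kw′ : T (keepV w′)} → IsTreeV R (w′ , kw′)
    tree-head (at-u _)     = IsTreeV-transfer (same-degrees (x , _)) tree-x
    tree-head (at-v hd≡v)  = ⊥-elim (tree-¬ret (subst (IsTreeV G) hd≡v tree) ret)
    tree-head (kept _ _)   = IsTreeV-transfer (same-degrees (hd i , _)) tree

  respecting : SNPRMinusRespecting n N e
  respecting = ret , inner-u , cu , cv , tl-cu , cu≢e , tl-cv , network-R , tree-child-R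

SNPRMinus-count : ∀ {n r} (N : FinGraph) → IsNetwork (toGraph N) n → IsTreeChild (toGraph N) →
  IsCount (IsRet (toGraph N)) r → IsCount (SNPRMinusRespecting n N) (r * 2)
SNPRMinus-count N net tc rets = IsCount-cong (SNPRMinusShape.respecting N net tc) (λ _ → proj₁)
  (TreeChildNetwork.ret-edges _≟_ _≟_ net tc rets)

lemma10 : (n r : ℕ) → 2 ≤ n → (N : FinGraph) →
    IsNetwork (toGraph N) n → IsTreeChild (toGraph N) →
    IsCount (IsRet (toGraph N)) r →
    (Σ ℕ λ k → IsCount (SNPRPlusRespecting n N) k ×
      ((δ : Fin (FinGraph.E N) → ℕ) → (s : ℕ) →
        (∀ e → DeltaT (toGraph N) e (δ e)) →
        SumOver (InEPS (toGraph N)) δ s →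
        + k ≡ + 4 *ℤ + n *ℤ + n -ℤ + 2 *ℤ + n *ℤ + r -ℤ + 8 *ℤ + n
              -ℤ + 2 *ℤ + r *ℤ + r +ℤ + 2 *ℤ + r +ℤ + 4 -ℤ + s))
    × IsCount (SNPRMinusRespecting n N) (2 * r)
lemma10 n r _ N net tc rets =
  (#respecting , respecting-count , respecting-formula rets) ,
  subst (IsCount (SNPRMinusRespecting n N)) (*-comm r 2) (SNPRMinus-count N net tc rets)
  where open SNPRPlusCount N net tc
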